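{- Let $A\in\mathbb{F}_2[x]$ be a nonconstant odd perfect polynomial. Then $$\sigma^*(A)=\sum_{D\mid A,\ D\neq 1,\ D\neq A}\sigma^*(D)\,\phi\!\left(\frac{A}{D}\right).$$
   Context: A nonzero $A\in\mathbb{F}_2[x]$ is odd if it has no irreducible factor of degree $1$. $\sigma(A)$ is the sum of all divisors of $A$ in $\mathbb{F}_2[x]$; $A$ is perfect if $\sigma(A)=A$. A divisor $D$ of $A$ is unitary if $\gcd(D,A/D)=1$, and $\sigma^*(A)$ is the sum of all unitary divisors of $A$. $\phi$ is the multiplicative function (i.e. $\phi(AB)=\phi(A)\phi(B)$ when $\gcd(A,B)=1$, $\phi(1)=1$) with $\phi(P^r)=P^r+P^{r-1}$ for $P$ irreducible, $r\ge1$. Sums over $D\mid A$ run over all divisors of $A$ in $\mathbb{F}_2[x]$. -}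

module Defs where

open import Data.Bool using (Bool; true; false; not; _xor_; if_then_else_)
open import Data.Nat using (ℕ; zero; suc; _≤_; _<_; z≤n; s≤s)
open import Data.Nat.Properties using (m≤m+n; ≤-refl; ≤-trans; n≤1+n; +-suc)
open import Data.List using (List; []; _∷_; map; _++_; filter; mapMaybe; foldr)
open import Data.List.Relation.Unary.Any as Any using (Any; here; there; any?; satisfied)
open import Data.List.Relation.Unary.All as All using (All; all?)
open import Data.List.Membership.Propositional using (_∈_)
open import Data.List.Membership.Propositional.Properties using (∈-map⁺; ∈-++⁺ˡ; ∈-++⁺ʳ)
open import Data.Maybe using (Maybe; just; nothing)
open import Data.Product using (Σ; ∃; _×_; _,_; proj₁; proj₂)
open import Data.Sum using (_⊎_)
open import Data.Empty using (⊥; ⊥-elim)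
open import Relation.Nullary using (Dec; yes; no; ¬_)
open import Relation.Nullary.Decidable using (_→-dec_; _×-dec_; ¬?)
open import Relation.Binary.PropositionalEquality using (_≡_; _≢_; refl; cong; sym; trans; subst)

-- Nonzero polynomials: `one` is the constant 1, and `b ∷⁺ p` is b + x·p.
-- Every nonzero polynomial in F₂[x] has exactly one such representation.
infixr 5 _∷⁺_
data P⁺ : Set where
  one  : P⁺
  _∷⁺_ : Bool → P⁺ → P⁺

data Poly : Set where
  𝟎  : Poly
  nz : P⁺ → Poly

𝟏 : Poly
𝟏 = nz one

deg : P⁺ → ℕ
deg one      = 0
deg (_ ∷⁺ p) = suc (deg p)

-- degree of a polynomial, with the convention deg 0 = 0 (only used together
-- with nonzero-ness or "≥ 1")
degP : Poly → ℕ
degP 𝟎      = 0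
degP (nz p) = deg p

cons : Bool → Poly → Poly
cons b 𝟎      = if b then 𝟏 else 𝟎
cons b (nz p) = nz (b ∷⁺ p)

_+⁺_ : P⁺ → P⁺ → Poly
one      +⁺ one      = 𝟎
one      +⁺ (b ∷⁺ q) = nz (not b ∷⁺ q)
(b ∷⁺ p) +⁺ one      = nz (not b ∷⁺ p)
(b ∷⁺ p) +⁺ (c ∷⁺ q) = cons (b xor c) (p +⁺ q)

infixl 6 _+_
infixl 7 _*_
infixr 8 _^_

_+_ : Poly → Poly → Poly
𝟎    + q    = q
nz p + 𝟎    = nz p
nz p + nz q = p +⁺ q

_*⁺_ : P⁺ → Poly → Poly
one      *⁺ q = q
(b ∷⁺ p) *⁺ q = (if b then q else 𝟎) + cons false (p *⁺ q)

_*_ : Poly → Poly → Poly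
𝟎    * q = 𝟎
nz p * q = p *⁺ q

_^_ : Poly → ℕ → Poly
P ^ zero  = 𝟏
P ^ suc n = P * P ^ n

infix 4 _∣_
_∣_ : Poly → Poly → Set
D ∣ A = ∃ λ Q → D * Q ≡ A

-- irreducible: nonconstant, and its only divisors are units (only 1 in F₂[x])
-- and associates (only itself in F₂[x])
Irreducible : Poly → Set
Irreducible P = (1 ≤ degP P) × (∀ D → D ∣ P → D ≡ 𝟏 ⊎ D ≡ P)

-- gcd(A, B) = 1 : the only common divisor (up to units, which are just 1) is 1
Coprime : Poly → Poly → Set
Coprime A B = ∀ E → E ∣ A → E ∣ B → E ≡ 𝟏

Odd : Poly → Set
Odd A = (A ≢ 𝟎) × (∀ P → Irreducible P → P ∣ A → degP P ≢ 1)

_≟⁺_ : (p q : P⁺) → Dec (p ≡ q)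
one ≟⁺ one = yes refl
one ≟⁺ (_ ∷⁺ _) = no λ ()
(_ ∷⁺ _) ≟⁺ one = no λ ()
(false ∷⁺ p) ≟⁺ (true ∷⁺ q) = no λ ()
(true ∷⁺ p) ≟⁺ (false ∷⁺ q) = no λ ()
(false ∷⁺ p) ≟⁺ (false ∷⁺ q) with p ≟⁺ q
... | yes refl = yes refl
... | no ne = no λ { refl → ne refl }
(true ∷⁺ p) ≟⁺ (true ∷⁺ q) with p ≟⁺ q
... | yes refl = yes refl
... | no ne = no λ { refl → ne refl }

infix 4 _≟_
_≟_ : (p q : Poly) → Dec (p ≡ q)
𝟎 ≟ 𝟎 = yes refl
𝟎 ≟ nz _ = no λ ()
nz _ ≟ 𝟎 = no λ ()
nz p ≟ nz q with p ≟⁺ q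
... | yes refl = yes refl
... | no ne = no λ { refl → ne refl }

allP⁺ : ℕ → List P⁺
allP⁺ zero    = one ∷ []
allP⁺ (suc n) = one ∷ (map (false ∷⁺_) (allP⁺ n) ++ map (true ∷⁺_) (allP⁺ n))

allP⁺-complete : ∀ p n → deg p ≤ n → p ∈ allP⁺ n
allP⁺-complete one zero _ = here refl
allP⁺-complete one (suc n) _ = here refl
allP⁺-complete (false ∷⁺ p) (suc n) (s≤s d) =
  there (∈-++⁺ˡ (∈-map⁺ (false ∷⁺_) (allP⁺-complete p n d)))
allP⁺-complete (true ∷⁺ p) (suc n) (s≤s d) =
  there (∈-++⁺ʳ (map (false ∷⁺_) (allP⁺ n)) (∈-map⁺ (true ∷⁺_) (allP⁺-complete p n d)))

+⁺-deg : ∀ q s → deg q < deg s → ∃ λ t → (q +⁺ s ≡ nz t) × (deg t ≡ deg s)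
+⁺-deg one (c ∷⁺ s) _ = (not c ∷⁺ s) , refl , refl
+⁺-deg (b ∷⁺ q) (c ∷⁺ s) (s≤s lt) with +⁺-deg q s lt
... | t , e , d rewrite e = ((b xor c) ∷⁺ t) , refl , cong suc d

*⁺-deg : ∀ p q → ∃ λ r → (p *⁺ nz q ≡ nz r) × (deg r ≡ Data.Nat._+_ (deg p) (deg q))
*⁺-deg one q = q , refl , refl
*⁺-deg (false ∷⁺ p) q with *⁺-deg p q
... | r , e , d rewrite e = (false ∷⁺ r) , refl , cong suc d
*⁺-deg (true ∷⁺ p) q with *⁺-deg p q
... | r , e , d rewrite e with +⁺-deg q (false ∷⁺ r) (s≤s (subst (deg q ≤_) (sym d) (lem (deg p) (deg q))))
  where
  lem : ∀ a b → b ≤ Data.Nat._+_ a b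
  lem zero b = ≤-refl
  lem (suc a) b = ≤-trans (lem a b) (n≤1+n _)
... | t , e′ , d′ = t , e′ , trans d′ (cong suc d)

𝟎+𝟎 : ∀ b → (if b then 𝟎 else 𝟎) + 𝟎 ≡ 𝟎
𝟎+𝟎 false = refl
𝟎+𝟎 true = refl

*⁺-𝟎 : ∀ p → p *⁺ 𝟎 ≡ 𝟎
*⁺-𝟎 one = refl
*⁺-𝟎 (b ∷⁺ p) rewrite *⁺-𝟎 p = 𝟎+𝟎 b

*-𝟎 : ∀ D → D * 𝟎 ≡ 𝟎
*-𝟎 𝟎 = refl
*-𝟎 (nz d) = *⁺-𝟎 d

∣-deg : ∀ d a → nz d ∣ nz a → deg d ≤ deg a
∣-deg d a (𝟎 , e) with trans (sym (*⁺-𝟎 d)) e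
... | ()
∣-deg d a (nz q , e) with *⁺-deg d q
... | r , e′ , dr with trans (sym e′) e
... | refl = subst (deg d ≤_) (sym dr) (m≤m+n (deg d) (deg q))

∣-deg-cofactor : ∀ d q a → nz d * nz q ≡ nz a → deg q ≤ deg a
∣-deg-cofactor d q a e with *⁺-deg d q
... | r , e′ , dr with trans (sym e′) e
... | refl = subst (deg q ≤_) (sym dr) (lem (deg d) (deg q))
  where
  lem : ∀ a b → b ≤ Data.Nat._+_ a b
  lem zero b = ≤-refl
  lem (suc a) b = ≤-trans (lem a b) (n≤1+n _)

∈⇒Any : ∀ {P : P⁺ → Set} {x xs} → x ∈ xs → P x → Any P xs
∈⇒Any (here refl) px = here px
∈⇒Any (there m) px = there (∈⇒Any m px)

infix 4 _∣?_
_∣?_ : (D A : Poly) → Dec (D ∣ A)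
D ∣? 𝟎 = yes (𝟎 , *-𝟎 D)
𝟎 ∣? nz a = no λ { (_ , ()) }
nz d ∣? nz a with any? (λ q → nz d * nz q ≟ nz a) (allP⁺ (deg a))
... | yes an = let (q , e) = satisfied an in yes (nz q , e)
... | no ¬an = no λ
  { (𝟎 , e) → ⊥-elim (lem (trans (sym (*⁺-𝟎 d)) e))
  ; (nz q , e) → ¬an (∈⇒Any (allP⁺-complete q (deg a) (∣-deg-cofactor d q a e)) e) }
  where
  lem : 𝟎 ≢ nz a
  lem ()

Coprime? : (d : P⁺) (B : Poly) → Dec (Coprime (nz d) B)
Coprime? d B with all? (λ e → (nz e ∣? nz d) →-dec ((nz e ∣? B) →-dec (nz e ≟ 𝟏))) (allP⁺ (deg d))
... | yes al = yes λ
  { 𝟎 (_ , ()) _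
  ; (nz e) ed eB → All.lookup al (allP⁺-complete e (deg d) (∣-deg e d ed)) ed eB }
... | no ¬al = no λ h → ¬al (All.tabulate λ {e} _ → h (nz e))

sumP : List Poly → Poly
sumP = foldr _+_ 𝟎

pairOf : (A : Poly) → P⁺ → Maybe (P⁺ × Poly)
pairOf A d with nz d ∣? A
... | yes (q , _) = just (d , q)
... | no _ = nothing

-- All pairs (D, A/D) with D ∣ A, for A nonzero (each divisor exactly once;
-- all divisors of a nonzero A are nonzero of degree ≤ deg A).
-- Convention: the empty list for A = 0 (never used for A = 0 below).
divisorPairs : Poly → List (P⁺ × Poly)
divisorPairs 𝟎      = []
divisorPairs (nz a) = mapMaybe (pairOf (nz a)) (allP⁺ (deg a))

IsUnitary : P⁺ × Poly → Set
IsUnitary (d , q) = Coprime (nz d) q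

IsUnitary? : ∀ x → Dec (IsUnitary x)
IsUnitary? (d , q) = Coprime? d q

-- σ(A) = Σ_{D ∣ A} D   (convention σ(0) = 0)
σ : Poly → Poly
σ A = sumP (map (λ x → nz (proj₁ x)) (divisorPairs A))

-- σ*(A) = Σ_{D ∣ A, gcd(D, A/D) = 1} D   (convention σ*(0) = 0)
σ* : Poly → Poly
σ* A = sumP (map (λ x → nz (proj₁ x)) (filter IsUnitary? (divisorPairs A)))

Perfect : Poly → Set
Perfect A = σ A ≡ A

IsPhi : (Poly → Poly) → Set
IsPhi φ = (φ 𝟏 ≡ 𝟏)
        × (∀ A B → Coprime A B → φ (A * B) ≡ φ A * φ B)
        × (∀ P r → Irreducible P → φ (P ^ suc r) ≡ P ^ suc r + P ^ r)

IsProper : Poly → P⁺ × Poly → Set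
IsProper A (d , _) = (nz d ≢ 𝟏) × (nz d ≢ A)

IsProper? : ∀ A x → Dec (IsProper A x)
IsProper? A (d , _) = ¬? (nz d ≟ 𝟏) ×-dec ¬? (nz d ≟ A)

-- Over F₂, the divisor sums σ, σ* and the convolution (σ* ⋆ φ)(A) = Σ_{D ∣ A} σ*(D) φ(A/D) are
-- multiplicative. At a prime power, σ*(P^i) = 1 + P^i for i ≥ 1 and Σ_{j ≤ n} φ(P^j) telescopes to
-- P^n; together these give (σ* ⋆ φ)(P^n) = (n + 1) φ(P^n) in characteristic 2. Hence σ* ⋆ φ = φ on
-- every polynomial whose irreducible factors all occur to an even power. An odd perfect polynomial A
-- is of this kind: if P^e exactly divides A with e odd, then 1 + P divides σ(P^e) and hence
-- σ(A) = A; but P has constant term 1, so x ∣ 1 + P ∣ A, contradicting oddness. Finally, the terms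
-- D = 1 and D = A of Σ_{D ∣ A} σ*(D) φ(A/D) = φ(A) contribute φ(A) + σ*(A), so the remaining terms
-- add up to σ*(A).

module Submission where

open import Defs
open import Data.Nat using (_≤_)
open import Data.List using (map; filter)
open import Data.Product using (_×_; _,_)
open import Relation.Binary.PropositionalEquality using (_≡_)

open import Algebra.Bundles using (CommutativeRing; CommutativeMonoid)
open import Algebra.Structures {A = Poly} _≡_ using (IsCommutativeRing)
open import Data.Bool using (Bool; true; false; _xor_; _∧_; if_then_else_)
open import Data.Bool.Properties using (xor-same; xor-assoc; xor-comm; xor-identityʳ; ∧-comm)
open import Data.Empty using (⊥-elim)
open import Data.List using (List; []; _∷_; _++_; mapMaybe; cartesianProduct)
open import Data.List.Properties using (map-∘)
open import Data.List.Membership.Propositional using (_∈_)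
open import Data.List.Membership.Propositional.Properties
  using (∈-map⁺; ∈-map⁻; ∈-++⁻; ∈-filter⁺; ∈-filter⁻; ∈-cartesianProduct⁺; ∈-cartesianProduct⁻)
open import Data.List.Membership.Propositional.Properties.WithK using (unique∧set⇒bag)
open import Data.List.Relation.Binary.BagAndSetEquality using (∼bag⇒↭)
open import Data.List.Relation.Binary.Permutation.Propositional using (_↭_; ↭⇒↭ₛ)
import Data.List.Relation.Binary.Permutation.Propositional.Properties as ↭
open import Data.List.Relation.Binary.Permutation.Setoid.Properties using (foldr-commMonoid)
import Data.List.Relation.Unary.All as All
open import Data.List.Relation.Unary.AllPairs using ([]; _∷_)
open import Data.List.Relation.Unary.Any using (here; there; any?; satisfied)
open import Data.List.Relation.Unary.Unique.Propositional using (Unique)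
import Data.List.Relation.Unary.Unique.Propositional.Properties as Unique
open import Data.Maybe using (nothing)
open import Data.Nat using (ℕ; zero; suc; z≤n; s≤s; _<_; parity) renaming (_+_ to _+ℕ_; _*_ to _*ℕ_)
import Data.Nat.Properties as ℕ
open import Data.Nat.Induction using (<-rec)
open import Data.Parity.Base using (0ℙ; 1ℙ)
open import Data.Product as Product using (∃; ∃₂; proj₁; proj₂; uncurry)
open import Data.Sum using (_⊎_; inj₁; inj₂)
open import Function using (_∘_; mk⇔)
open import Relation.Nullary using (¬_; Dec; yes; no; does; ¬?)
open import Relation.Nullary.Decidable using (_×-dec_)
open import Relation.Unary using (Decidable)
open import Relation.Binary.PropositionalEquality
  using (_≢_; refl; sym; trans; cong; cong₂; subst; subst₂; isEquivalence; module ≡-Reasoning)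
open import Tactic.RingSolver using (solve-∀)
open import Tactic.RingSolver.Core.AlmostCommutativeRing using (AlmostCommutativeRing; fromCommutativeRing)

open ≡-Reasoning

-- The commutative ring F₂[x]

coeff⁺ : P⁺ → ℕ → Bool
coeff⁺ one      zero    = true
coeff⁺ one      (suc n) = false
coeff⁺ (b ∷⁺ p) zero    = b
coeff⁺ (b ∷⁺ p) (suc n) = coeff⁺ p n

coeff : Poly → ℕ → Bool
coeff 𝟎      n = false
coeff (nz p) n = coeff⁺ p n

coeff-leading : ∀ p → coeff⁺ p (deg p) ≡ true
coeff-leading one      = refl
coeff-leading (b ∷⁺ p) = coeff-leading p

coeff-injective : ∀ p q → (∀ n → coeff p n ≡ coeff q n) → p ≡ q
coeff-injective 𝟎 𝟎 _ = refl
coeff-injective 𝟎 (nz q) h with () ← trans (h (deg q)) (coeff-leading q)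
coeff-injective (nz p) 𝟎 h with () ← trans (sym (h (deg p))) (coeff-leading p)
coeff-injective (nz one) (nz one) h = refl
coeff-injective (nz one) (nz (c ∷⁺ q)) h with () ← trans (h (suc (deg q))) (coeff-leading q)
coeff-injective (nz (b ∷⁺ p)) (nz one) h with () ← trans (sym (h (suc (deg p)))) (coeff-leading p)
coeff-injective (nz (b ∷⁺ p)) (nz (c ∷⁺ q)) h
  with refl ← h zero | refl ← coeff-injective (nz p) (nz q) (λ n → h (suc n)) = refl

coeff-cons-zero : ∀ b p → coeff (cons b p) zero ≡ b
coeff-cons-zero false 𝟎      = refl
coeff-cons-zero true  𝟎      = refl
coeff-cons-zero b     (nz p) = refl

coeff-cons-suc : ∀ b p n → coeff (cons b p) (suc n) ≡ coeff p n
coeff-cons-suc false 𝟎      n = refl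
coeff-cons-suc true  𝟎      n = refl
coeff-cons-suc b     (nz p) n = refl

coeff-+⁺ : ∀ p q n → coeff (p +⁺ q) n ≡ coeff⁺ p n xor coeff⁺ q n
coeff-+⁺ one      one      zero    = refl
coeff-+⁺ one      one      (suc n) = refl
coeff-+⁺ one      (c ∷⁺ q) zero    = refl
coeff-+⁺ one      (c ∷⁺ q) (suc n) = refl
coeff-+⁺ (b ∷⁺ p) one      zero    = sym (xor-comm b true)
coeff-+⁺ (b ∷⁺ p) one      (suc n) = sym (xor-identityʳ _)
coeff-+⁺ (b ∷⁺ p) (c ∷⁺ q) zero    = coeff-cons-zero (b xor c) (p +⁺ q)
coeff-+⁺ (b ∷⁺ p) (c ∷⁺ q) (suc n) = trans (coeff-cons-suc (b xor c) (p +⁺ q) n) (coeff-+⁺ p q n)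

coeff-+ : ∀ p q n → coeff (p + q) n ≡ coeff p n xor coeff q n
coeff-+ 𝟎      q      n = refl
coeff-+ (nz p) 𝟎      n = sym (xor-identityʳ _)
coeff-+ (nz p) (nz q) n = coeff-+⁺ p q n

+-identityʳ : ∀ p → p + 𝟎 ≡ p
+-identityʳ 𝟎      = refl
+-identityʳ (nz p) = refl

+-comm : ∀ p q → p + q ≡ q + p
+-comm p q = coeff-injective _ _ λ n → begin
  coeff (p + q) n           ≡⟨ coeff-+ p q n ⟩
  coeff p n xor coeff q n   ≡⟨ xor-comm (coeff p n) (coeff q n) ⟩
  coeff q n xor coeff p n   ≡⟨ coeff-+ q p n ⟨
  coeff (q + p) n           ∎

+-assoc : ∀ p q r → (p + q) + r ≡ p + (q + r)
+-assoc p q r = coeff-injective _ _ λ n → begin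
  coeff ((p + q) + r) n                     ≡⟨ coeff-+ (p + q) r n ⟩
  coeff (p + q) n xor coeff r n             ≡⟨ cong (_xor coeff r n) (coeff-+ p q n) ⟩
  (coeff p n xor coeff q n) xor coeff r n   ≡⟨ xor-assoc (coeff p n) (coeff q n) (coeff r n) ⟩
  coeff p n xor (coeff q n xor coeff r n)   ≡⟨ cong (coeff p n xor_) (coeff-+ q r n) ⟨
  coeff p n xor coeff (q + r) n             ≡⟨ coeff-+ p (q + r) n ⟨
  coeff (p + (q + r)) n                     ∎

p+p≡𝟎 : ∀ p → p + p ≡ 𝟎
p+p≡𝟎 p = coeff-injective _ _ λ n → trans (coeff-+ p p n) (xor-same (coeff p n))

cons-induction : (Q : Poly → Set) → Q 𝟎 → (∀ b p → Q p → Q (cons b p)) → ∀ p → Q p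
cons-induction Q base step 𝟎             = base
cons-induction Q base step (nz one)      = step true 𝟎 base
cons-induction Q base step (nz (b ∷⁺ p)) = step b (nz p) (cons-induction Q base step (nz p))

cons-split : ∀ p → ∃₂ λ b p′ → cons b p′ ≡ p
cons-split 𝟎             = false , 𝟎 , refl
cons-split (nz one)      = true , 𝟎 , refl
cons-split (nz (b ∷⁺ p)) = b , nz p , refl

x* : Poly → Poly
x* = cons false

select : Bool → Poly → Poly
select b q = if b then q else 𝟎

cons-+-cons : ∀ b c p q → cons b p + cons c q ≡ cons (b xor c) (p + q)
cons-+-cons b c p q = coeff-injective _ _ λ where
  zero → begin
    coeff (cons b p + cons c q) zero                   ≡⟨ coeff-+ (cons b p) (cons c q) zero ⟩
    coeff (cons b p) zero xor coeff (cons c q) zero    ≡⟨ cong₂ _xor_ (coeff-cons-zero b p) (coeff-cons-zero c q) ⟩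
    b xor c                                            ≡⟨ coeff-cons-zero (b xor c) (p + q) ⟨
    coeff (cons (b xor c) (p + q)) zero                ∎
  (suc n) → begin
    coeff (cons b p + cons c q) (suc n)                      ≡⟨ coeff-+ (cons b p) (cons c q) (suc n) ⟩
    coeff (cons b p) (suc n) xor coeff (cons c q) (suc n)    ≡⟨ cong₂ _xor_ (coeff-cons-suc b p n) (coeff-cons-suc c q n) ⟩
    coeff p n xor coeff q n                                  ≡⟨ coeff-+ p q n ⟨
    coeff (p + q) n                                          ≡⟨ coeff-cons-suc (b xor c) (p + q) n ⟨
    coeff (cons (b xor c) (p + q)) (suc n)                   ∎

+-swap-left : ∀ a b c → a + (b + c) ≡ b + (a + c)
+-swap-left a b c = trans (sym (+-assoc a b c)) (trans (cong (_+ c) (+-comm a b)) (+-assoc b a c))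

+-interchange : ∀ a b c d → (a + b) + (c + d) ≡ (a + c) + (b + d)
+-interchange a b c d =
  trans (+-assoc a b (c + d)) (trans (cong (a +_) (+-swap-left b c d)) (sym (+-assoc a c (b + d))))

a+b+b≡a : ∀ a b → a + b + b ≡ a
a+b+b≡a a b = trans (+-assoc a b b) (trans (cong (a +_) (p+p≡𝟎 b)) (+-identityʳ a))

a+b+a≡b : ∀ a b → a + b + a ≡ b
a+b+a≡b a b = trans (cong (_+ a) (+-comm a b)) (a+b+b≡a b a)

cons-+-x* : ∀ b p q → cons b p + x* q ≡ cons b (p + q)
cons-+-x* b p q = trans (cons-+-cons b false p q) (cong (λ c → cons c (p + q)) (xor-identityʳ b))

x*-+ : ∀ p q → x* p + x* q ≡ x* (p + q)
x*-+ = cons-+-x* false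

cons-* : ∀ b p q → cons b p * q ≡ select b q + x* (p * q)
cons-* false 𝟎      q = refl
cons-* true  𝟎      q = sym (+-identityʳ q)
cons-* b     (nz p) q = refl

select-xor : ∀ b c q → select (b xor c) q ≡ select b q + select c q
select-xor false c     q = refl
select-xor true  false q = sym (+-identityʳ q)
select-xor true  true  q = sym (p+p≡𝟎 q)

select-cons : ∀ b c q → select b (cons c q) ≡ cons (b ∧ c) (select b q)
select-cons false c q = refl
select-cons true  c q = refl

select-* : ∀ b q r → select b q * r ≡ select b (q * r)
select-* false q r = refl
select-* true  q r = refl

*-identityʳ : ∀ p → p * 𝟏 ≡ p
*-identityʳ = cons-induction _ refl λ b p ih → begin
  cons b p * 𝟏            ≡⟨ cons-* b p 𝟏 ⟩
  select b 𝟏 + x* (p * 𝟏) ≡⟨ cong (λ r → select b 𝟏 + x* r) ih ⟩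
  select b 𝟏 + x* p       ≡⟨ select-𝟏 b p ⟩
  cons b p                ∎
  where
  select-𝟏 : ∀ b p → select b 𝟏 + x* p ≡ cons b p
  select-𝟏 false p = refl
  select-𝟏 true  p = cons-+-x* true 𝟎 p

*-distribʳ : ∀ r p q → (p + q) * r ≡ p * r + q * r
*-distribʳ r = cons-induction (λ p → ∀ q → (p + q) * r ≡ p * r + q * r) (λ q → refl) step
  where
  step : ∀ b p → (∀ q → (p + q) * r ≡ p * r + q * r) → ∀ q → (cons b p + q) * r ≡ cons b p * r + q * r
  step b p ih q with c , q′ , refl ← cons-split q = begin
    (cons b p + cons c q′) * r                              ≡⟨ cong (_* r) (cons-+-cons b c p q′) ⟩
    cons (b xor c) (p + q′) * r                             ≡⟨ cons-* (b xor c) (p + q′) r ⟩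
    select (b xor c) r + x* ((p + q′) * r)                  ≡⟨ cong₂ _+_ (select-xor b c r) (cong x* (ih q′)) ⟩
    (select b r + select c r) + x* (p * r + q′ * r)         ≡⟨ cong ((select b r + select c r) +_) (x*-+ (p * r) (q′ * r)) ⟨
    (select b r + select c r) + (x* (p * r) + x* (q′ * r))  ≡⟨ +-interchange (select b r) (select c r) _ _ ⟩
    (select b r + x* (p * r)) + (select c r + x* (q′ * r))  ≡⟨ cong₂ _+_ (cons-* b p r) (cons-* c q′ r) ⟨
    cons b p * r + cons c q′ * r                            ∎

*-cons : ∀ c q p → p * cons c q ≡ select c p + x* (p * q)
*-cons c q = cons-induction _ (sym (select-𝟎 c)) λ b p ih → begin
  cons b p * cons c q                                 ≡⟨ cons-* b p (cons c q) ⟩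
  select b (cons c q) + x* (p * cons c q)             ≡⟨ cong₂ _+_ (select-cons b c q) (cong x* ih) ⟩
  cons (b ∧ c) (select b q) + x* (select c p + x* (p * q))
    ≡⟨ cons-+-x* (b ∧ c) (select b q) _ ⟩
  cons (b ∧ c) (select b q + (select c p + x* (p * q)))
    ≡⟨ cong₂ cons (∧-comm b c) (+-swap-left (select b q) (select c p) _) ⟩
  cons (c ∧ b) (select c p + (select b q + x* (p * q)))
    ≡⟨ cons-+-x* (c ∧ b) (select c p) _ ⟨
  cons (c ∧ b) (select c p) + x* (select b q + x* (p * q))
    ≡⟨ cong₂ _+_ (select-cons c b p) (cong x* (cons-* b p q)) ⟨
  select c (cons b p) + x* (cons b p * q)             ∎
  where
  select-𝟎 : ∀ c → select c 𝟎 + 𝟎 ≡ 𝟎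
  select-𝟎 false = refl
  select-𝟎 true  = refl

*-comm : ∀ p q → p * q ≡ q * p
*-comm = cons-induction (λ p → ∀ q → p * q ≡ q * p) (λ q → sym (*-𝟎 q)) λ b p ih q → begin
  cons b p * q            ≡⟨ cons-* b p q ⟩
  select b q + x* (p * q) ≡⟨ cong (λ r → select b q + x* r) (ih q) ⟩
  select b q + x* (q * p) ≡⟨ *-cons b p q ⟨
  q * cons b p            ∎

*-distribˡ : ∀ r p q → r * (p + q) ≡ r * p + r * q
*-distribˡ r p q = trans (*-comm r (p + q)) (trans (*-distribʳ r p q) (cong₂ _+_ (*-comm p r) (*-comm q r)))

*-assoc : ∀ p q r → (p * q) * r ≡ p * (q * r)
*-assoc p q r = cons-induction (λ p → (p * q) * r ≡ p * (q * r)) refl (λ b p ih → begin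
  (cons b p * q) * r              ≡⟨ cong (_* r) (cons-* b p q) ⟩
  (select b q + x* (p * q)) * r   ≡⟨ *-distribʳ r (select b q) (x* (p * q)) ⟩
  select b q * r + x* (p * q) * r ≡⟨ cong₂ _+_ (select-* b q r) (trans (cons-* false (p * q) r) (cong x* ih)) ⟩
  select b (q * r) + x* (p * (q * r)) ≡⟨ cons-* b p (q * r) ⟨
  cons b p * (q * r)              ∎) p

+-*-isCommutativeRing : IsCommutativeRing _+_ _*_ (λ p → p) 𝟎 𝟏
+-*-isCommutativeRing = record
  { isRing = record
    { +-isAbelianGroup = record
      { isGroup = record
        { isMonoid = record
          { isSemigroup = record
            { isMagma = record { isEquivalence = isEquivalence ; ∙-cong = cong₂ _+_ }
            ; assoc = +-assoc }
          ; identity = (λ _ → refl) , +-identityʳ }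
        ; inverse = p+p≡𝟎 , p+p≡𝟎
        ; ⁻¹-cong = λ e → e }
      ; comm = +-comm }
    ; *-cong = cong₂ _*_
    ; *-assoc = *-assoc
    ; *-identity = (λ _ → refl) , *-identityʳ
    ; distrib = *-distribˡ , *-distribʳ }
  ; *-comm = *-comm }

commutativeRing : CommutativeRing _ _
commutativeRing = record { isCommutativeRing = +-*-isCommutativeRing }

-- The solver only uses the zero test to prune terms, so answering `nothing` is sound. It proves
-- identities of all commutative rings; steps using p + p ≡ 𝟎 are done by hand.
ring : AlmostCommutativeRing _ _
ring = fromCommutativeRing commutativeRing (λ _ → nothing)

*-interchange : ∀ a b c d → (a * b) * (c * d) ≡ (a * c) * (b * d)
*-interchange = solve-∀ ring

*-swap-left : ∀ a b c → a * (b * c) ≡ b * (a * c)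
*-swap-left = solve-∀ ring

-- Divisibility, Bézout's identity and Euclid's lemma

nz≢𝟎 : ∀ p → nz p ≢ 𝟎
nz≢𝟎 p ()

*-≢𝟎 : ∀ {a b} → a ≢ 𝟎 → b ≢ 𝟎 → a * b ≢ 𝟎
*-≢𝟎 {𝟎}             a≢𝟎 _   = ⊥-elim (a≢𝟎 refl)
*-≢𝟎 {nz p} {𝟎}      _   b≢𝟎 = ⊥-elim (b≢𝟎 refl)
*-≢𝟎 {nz p} {nz q}   _   _   with r , e , _ ← *⁺-deg p q = subst (_≢ 𝟎) (sym e) (nz≢𝟎 r)

*-≢𝟎⇒≢𝟎ˡ : ∀ a b → a * b ≢ 𝟎 → a ≢ 𝟎
*-≢𝟎⇒≢𝟎ˡ a b ab≢𝟎 refl = ab≢𝟎 refl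

*-≢𝟎⇒≢𝟎ʳ : ∀ a b → a * b ≢ 𝟎 → b ≢ 𝟎
*-≢𝟎⇒≢𝟎ʳ a b ab≢𝟎 refl = ab≢𝟎 (*-𝟎 a)

*≡𝟎⇒≡𝟎 : ∀ {a b} → a ≢ 𝟎 → a * b ≡ 𝟎 → b ≡ 𝟎
*≡𝟎⇒≡𝟎 {b = 𝟎}    _   _    = refl
*≡𝟎⇒≡𝟎 {b = nz q} a≢𝟎 ab≡𝟎 = ⊥-elim (*-≢𝟎 a≢𝟎 (nz≢𝟎 q) ab≡𝟎)

+≡𝟎⇒≡ : ∀ a b → a + b ≡ 𝟎 → a ≡ b
+≡𝟎⇒≡ a b a+b≡𝟎 = trans (sym (a+b+b≡a a b)) (cong (_+ b) a+b≡𝟎)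

*-cancelˡ : ∀ a {b c} → a ≢ 𝟎 → a * b ≡ a * c → b ≡ c
*-cancelˡ a {b} {c} a≢𝟎 ab≡ac = +≡𝟎⇒≡ b c (*≡𝟎⇒≡𝟎 a≢𝟎 (begin
  a * (b + c)     ≡⟨ *-distribˡ a b c ⟩
  a * b + a * c   ≡⟨ cong (_+ a * c) ab≡ac ⟩
  a * c + a * c   ≡⟨ p+p≡𝟎 (a * c) ⟩
  𝟎               ∎))

*≡𝟏⇒≡𝟏 : ∀ a b → a * b ≡ 𝟏 → a ≡ 𝟏
*≡𝟏⇒≡𝟏 𝟎             b      ()
*≡𝟏⇒≡𝟏 (nz p)        𝟎      e = ⊥-elim (nz≢𝟎 one (trans (sym e) (*⁺-𝟎 p)))
*≡𝟏⇒≡𝟏 (nz one)      (nz q) e = refl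
*≡𝟏⇒≡𝟏 (nz (b ∷⁺ p)) (nz q) e
  with r , e′ , deg-r ← *⁺-deg (b ∷⁺ p) q with refl ← trans (sym e′) e with () ← deg-r

degP-* : ∀ {a b} → a ≢ 𝟎 → b ≢ 𝟎 → degP (a * b) ≡ degP a +ℕ degP b
degP-* {𝟎}           a≢𝟎 _   = ⊥-elim (a≢𝟎 refl)
degP-* {nz p} {𝟎}    _   b≢𝟎 = ⊥-elim (b≢𝟎 refl)
degP-* {nz p} {nz q} _   _   with r , e , d ← *⁺-deg p q = trans (cong degP e) d

∣-refl : ∀ a → a ∣ a
∣-refl a = 𝟏 , *-identityʳ a

∣-trans : ∀ a {b c} → a ∣ b → b ∣ c → a ∣ c
∣-trans a (q , refl) (r , refl) = q * r , sym (*-assoc a q r)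

m∣m*n : ∀ a b → a ∣ a * b
m∣m*n a b = b , refl

n∣m*n : ∀ a b → b ∣ a * b
n∣m*n a b = a , *-comm b a

∣m⇒∣m*n : ∀ a {b} c → a ∣ b → a ∣ b * c
∣m⇒∣m*n a c (q , refl) = q * c , sym (*-assoc a q c)

∣n⇒∣m*n : ∀ a {b} c → a ∣ b → a ∣ c * b
∣n⇒∣m*n a {b} c a∣b = subst (a ∣_) (*-comm b c) (∣m⇒∣m*n a c a∣b)

∣m∣n⇒∣m+n : ∀ a {b c} → a ∣ b → a ∣ c → a ∣ b + c
∣m∣n⇒∣m+n a (q , refl) (r , refl) = q + r , *-distribˡ a q r

∣𝟎 : ∀ a → a ∣ 𝟎
∣𝟎 a = 𝟎 , *-𝟎 a

∣⇒≢𝟎 : ∀ {a b} → a ∣ b → b ≢ 𝟎 → a ≢ 𝟎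
∣⇒≢𝟎 (q , refl) b≢𝟎 refl = b≢𝟎 refl

∣-antisym : ∀ {a b} → a ∣ b → b ∣ a → a ≢ 𝟎 → a ≡ b
∣-antisym {a} {b} (q , refl) (r , e) a≢𝟎 = begin
  a         ≡⟨ *-identityʳ a ⟨
  a * 𝟏     ≡⟨ cong (a *_) (*≡𝟏⇒≡𝟏 q r q*r≡𝟏) ⟨
  a * q     ∎
  where
  q*r≡𝟏 : q * r ≡ 𝟏
  q*r≡𝟏 = *-cancelˡ a a≢𝟎 (trans (sym (*-assoc a q r)) (trans e (sym (*-identityʳ a))))

ReducedMod : Poly → P⁺ → Set
ReducedMod r b = r ≡ 𝟎 ⊎ degP r < deg b

record DivMod (a : Poly) (b : P⁺) : Set where
  constructor divMod
  field
    quotient remainder : Poly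
    property : a ≡ quotient * nz b + remainder
    reduced : ReducedMod remainder b

+⁺-same-deg : ∀ p q → deg p ≡ deg q → ReducedMod (p +⁺ q) p
+⁺-same-deg one      one      _ = inj₁ refl
+⁺-same-deg (b ∷⁺ p) (c ∷⁺ q) e with p +⁺ q | +⁺-same-deg p q (ℕ.suc-injective e)
... | 𝟎    | _       = inj₂ (cons-deg (b xor c))
  where
  cons-deg : ∀ x → degP (cons x 𝟎) < suc (deg p)
  cons-deg false = s≤s z≤n
  cons-deg true  = s≤s z≤n
... | nz s | inj₂ lt = inj₂ (s≤s lt)

cons-reduced : ∀ c r b → ReducedMod r b → cons c r ≡ 𝟎 ⊎ degP (cons c r) ≤ deg b
cons-reduced false 𝟎      b _        = inj₁ refl
cons-reduced true  𝟎      b _        = inj₂ z≤n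
cons-reduced c     (nz s) b (inj₂ lt) = inj₂ lt

-- A remainder of the same degree as b is reduced by adding b once more.
divMod-≤ : ∀ {a b} q r → a ≡ q * nz b + r → r ≡ 𝟎 ⊎ degP r ≤ deg b → DivMod a b
divMod-≤ q r      a≡qb+r (inj₁ r≡𝟎) = divMod q r a≡qb+r (inj₁ r≡𝟎)
divMod-≤ q 𝟎      a≡qb+r (inj₂ _)   = divMod q 𝟎 a≡qb+r (inj₁ refl)
divMod-≤ {a} {b} q (nz s) a≡qb+s (inj₂ s≤b) with ℕ.m≤n⇒m<n∨m≡n s≤b
... | inj₁ s<b = divMod q (nz s) a≡qb+s (inj₂ s<b)
... | inj₂ s≡b = divMod (q + 𝟏) (s +⁺ b) a≡[q+1]b+[s+b] s+b-reduced
  where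
  s+b-reduced : ReducedMod (s +⁺ b) b
  s+b-reduced with +⁺-same-deg s b s≡b
  ... | inj₁ s+b≡𝟎 = inj₁ s+b≡𝟎
  ... | inj₂ lt    = inj₂ (subst (degP (s +⁺ b) <_) s≡b lt)
  a≡[q+1]b+[s+b] : a ≡ (q + 𝟏) * nz b + (s +⁺ b)
  a≡[q+1]b+[s+b] = begin
    a                                 ≡⟨ a≡qb+s ⟩
    q * nz b + nz s                   ≡⟨ a+b+b≡a (q * nz b + nz s) (nz b) ⟨
    (q * nz b + nz s) + nz b + nz b   ≡⟨ +-assoc (q * nz b + nz s) (nz b) (nz b) ⟩
    (q * nz b + nz s) + (nz b + nz b) ≡⟨ +-interchange (q * nz b) (nz s) (nz b) (nz b) ⟩
    (q * nz b + nz b) + (nz s + nz b) ≡⟨ cong (_+ (nz s + nz b)) (*-distribʳ (nz b) q 𝟏) ⟨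
    (q + 𝟏) * nz b + (s +⁺ b)         ∎

divMod-by : ∀ a b → DivMod a b
divMod-by a b = cons-induction (λ a → DivMod a b) (divMod 𝟎 𝟎 refl (inj₁ refl)) step a
  where
  step : ∀ c a → DivMod a b → DivMod (cons c a) b
  step c a (divMod q r a≡qb+r r-reduced) = divMod-≤ (x* q) (cons c r) shifted (cons-reduced c r b r-reduced)
    where
    shifted : cons c a ≡ x* q * nz b + cons c r
    shifted = begin
      cons c a                            ≡⟨ cons-+-x* c 𝟎 a ⟨
      cons c 𝟎 + x* a                     ≡⟨ cong (λ z → cons c 𝟎 + x* z) a≡qb+r ⟩
      cons c 𝟎 + x* (q * nz b + r)        ≡⟨ cong (cons c 𝟎 +_) (x*-+ (q * nz b) r) ⟨
      cons c 𝟎 + (x* (q * nz b) + x* r)   ≡⟨ +-swap-left (cons c 𝟎) (x* (q * nz b)) (x* r) ⟩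
      x* (q * nz b) + (cons c 𝟎 + x* r)   ≡⟨ cong₂ _+_ (sym (cons-* false q (nz b))) (cons-+-x* c 𝟎 r) ⟩
      x* q * nz b + cons c r              ∎

record Bézout (a b : Poly) : Set where
  constructor bézout
  field
    gcd u v : Poly
    gcd∣a : gcd ∣ a
    gcd∣b : gcd ∣ b
    identity : gcd ≡ u * a + v * b

size : Poly → ℕ
size 𝟎      = 0
size (nz p) = suc (deg p)

size-reduced : ∀ {b n} r → ReducedMod r b → deg b ≤ n → size r ≤ n
size-reduced 𝟎      _         _       = z≤n
size-reduced (nz s) (inj₂ lt) deg-b≤n = ℕ.≤-trans lt deg-b≤n

bézout-by-fuel : ∀ n a b → size b ≤ n → Bézout a b
bézout-by-fuel n       a 𝟎      _ = bézout a 𝟏 𝟎 (∣-refl a) (∣𝟎 a) (sym (+-identityʳ (𝟏 * a)))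
bézout-by-fuel (suc n) a (nz b) (s≤s deg-b≤n)
  with divMod q r a≡qb+r red ← divMod-by a b
  with bézout g u v g∣b g∣r g≡ub+vr ← bézout-by-fuel n (nz b) r (size-reduced r red deg-b≤n)
  = bézout g v (u + v * q) g∣a g∣b g≡va+[u+vq]b
  where
  g∣a : g ∣ a
  g∣a = subst (g ∣_) (sym a≡qb+r) (∣m∣n⇒∣m+n g (∣n⇒∣m*n g q g∣b) g∣r)
  r≡a+qb : r ≡ a + q * nz b
  r≡a+qb = begin
    r                          ≡⟨ cong (_+ r) (p+p≡𝟎 (q * nz b)) ⟨
    (q * nz b + q * nz b) + r  ≡⟨ +-assoc (q * nz b) (q * nz b) r ⟩
    q * nz b + (q * nz b + r)  ≡⟨ cong (q * nz b +_) a≡qb+r ⟨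
    q * nz b + a               ≡⟨ +-comm (q * nz b) a ⟩
    a + q * nz b               ∎
  regroup : ∀ a b q u v → u * b + v * (a + q * b) ≡ v * a + (u + v * q) * b
  regroup = solve-∀ ring
  g≡va+[u+vq]b : g ≡ v * a + (u + v * q) * nz b
  g≡va+[u+vq]b = trans g≡ub+vr (trans (cong (λ z → u * nz b + v * z) r≡a+qb) (regroup a (nz b) q u v))

bézout-of : ∀ a b → Bézout a b
bézout-of a b = bézout-by-fuel (size b) a b ℕ.≤-refl

Coprime⇒bézout : ∀ {a b} → Coprime a b → ∃₂ λ u v → u * a + v * b ≡ 𝟏
Coprime⇒bézout {a} {b} a⊥b with bézout g u v g∣a g∣b g≡ua+vb ← bézout-of a b =
  u , v , trans (sym g≡ua+vb) (a⊥b g g∣a g∣b)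

bézout⇒Coprime : ∀ {a b} u v → u * a + v * b ≡ 𝟏 → Coprime a b
bézout⇒Coprime {a} {b} u v ua+vb≡𝟏 e e∣a e∣b =
  *≡𝟏⇒≡𝟏 e _ (trans (proj₂ e∣ua+vb) ua+vb≡𝟏)
  where
  e∣ua+vb : e ∣ u * a + v * b
  e∣ua+vb = ∣m∣n⇒∣m+n e (∣n⇒∣m*n e u e∣a) (∣n⇒∣m*n e v e∣b)

coprime-divisor : ∀ {a b c} → Coprime a b → a ∣ b * c → a ∣ c
coprime-divisor {a} {b} {c} a⊥b a∣bc with u , v , ua+vb≡𝟏 ← Coprime⇒bézout a⊥b =
  subst (a ∣_) c≡ (∣m∣n⇒∣m+n a (n∣m*n (u * c) a) (∣n⇒∣m*n a v a∣bc))
  where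
  regroup : ∀ a b c u v → (u * c) * a + v * (b * c) ≡ (u * a + v * b) * c
  regroup = solve-∀ ring
  c≡ : (u * c) * a + v * (b * c) ≡ c
  c≡ = trans (regroup a b c u v) (cong (_* c) ua+vb≡𝟏)

Coprime-sym : ∀ {a b} → Coprime a b → Coprime b a
Coprime-sym a⊥b e e∣b e∣a = a⊥b e e∣a e∣b

Coprime-∣ : ∀ {a b c d} → Coprime a b → c ∣ a → d ∣ b → Coprime c d
Coprime-∣ a⊥b c∣a d∣b e e∣c e∣d = a⊥b e (∣-trans e e∣c c∣a) (∣-trans e e∣d d∣b)

Coprime-*ˡ : ∀ {a b c} → Coprime a c → Coprime b c → Coprime (a * b) c
Coprime-*ˡ {a} {b} a⊥c b⊥c e e∣ab e∣c =
  b⊥c e (coprime-divisor {e} {a} (Coprime-∣ (Coprime-sym a⊥c) e∣c (∣-refl a)) e∣ab) e∣c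

Coprime-*ʳ : ∀ {a b c} → Coprime a b → Coprime a c → Coprime a (b * c)
Coprime-*ʳ a⊥b a⊥c = Coprime-sym (Coprime-*ˡ (Coprime-sym a⊥b) (Coprime-sym a⊥c))

Coprime-𝟏ˡ : ∀ a → Coprime 𝟏 a
Coprime-𝟏ˡ a e (q , e*q≡𝟏) _ = *≡𝟏⇒≡𝟏 e q e*q≡𝟏

euclidsLemma : ∀ {p} a b → Irreducible p → p ∣ a * b → p ∣ a ⊎ p ∣ b
euclidsLemma {p} a b (_ , p-irr) p∣ab with bézout g u v g∣p g∣a g≡up+va ← bézout-of p a with p-irr g g∣p
... | inj₂ refl = inj₁ g∣a
... | inj₁ refl = inj₂ (coprime-divisor (bézout⇒Coprime u v (sym g≡up+va)) p∣ab)

-- Divisor sums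

∑ : {A : Set} → List A → (A → Poly) → Poly
∑ xs f = sumP (map f xs)

∑-++ : {A : Set} (xs ys : List A) (f : A → Poly) → ∑ (xs ++ ys) f ≡ ∑ xs f + ∑ ys f
∑-++ []       ys f = refl
∑-++ (x ∷ xs) ys f = trans (cong (f x +_) (∑-++ xs ys f)) (sym (+-assoc (f x) (∑ xs f) (∑ ys f)))

∑-map : {A B : Set} (g : A → B) (xs : List A) (f : B → Poly) → ∑ (map g xs) f ≡ ∑ xs (f ∘ g)
∑-map g xs f = cong sumP (sym (map-∘ xs))

∑-cong : {A : Set} {f g : A → Poly} (xs : List A) → (∀ {x} → x ∈ xs → f x ≡ g x) → ∑ xs f ≡ ∑ xs g
∑-cong []       f≡g = refl
∑-cong (x ∷ xs) f≡g = cong₂ _+_ (f≡g (here refl)) (∑-cong xs (f≡g ∘ there))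

∑-+ : {A : Set} (xs : List A) (f g : A → Poly) → ∑ xs (λ x → f x + g x) ≡ ∑ xs f + ∑ xs g
∑-+ []       f g = refl
∑-+ (x ∷ xs) f g = trans (cong (f x + g x +_) (∑-+ xs f g)) (+-interchange (f x) (g x) (∑ xs f) (∑ xs g))

∑-↭ : {A : Set} {xs ys : List A} (f : A → Poly) → xs ↭ ys → ∑ xs f ≡ ∑ ys f
∑-↭ f xs↭ys = foldr-commMonoid +-0.setoid +-0.isCommutativeMonoid (↭⇒↭ₛ (↭.map⁺ f xs↭ys))
  where module +-0 = CommutativeMonoid (CommutativeRing.+-commutativeMonoid commutativeRing)

∑-*ˡ : {A : Set} (xs : List A) (f : A → Poly) (c : Poly) → c * ∑ xs f ≡ ∑ xs (λ x → c * f x)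
∑-*ˡ []       f c = *-𝟎 c
∑-*ˡ (x ∷ xs) f c = trans (*-distribˡ c (f x) (∑ xs f)) (cong (c * f x +_) (∑-*ˡ xs f c))

∑-cartesianProduct : {A B : Set} (xs : List A) (ys : List B) (f : A → Poly) (g : B → Poly) →
                     ∑ (cartesianProduct xs ys) (λ (x , y) → f x * g y) ≡ ∑ xs f * ∑ ys g
∑-cartesianProduct []       ys f g = refl
∑-cartesianProduct (x ∷ xs) ys f g = begin
  ∑ (map (x ,_) ys ++ cartesianProduct xs ys) h
    ≡⟨ ∑-++ (map (x ,_) ys) _ h ⟩
  ∑ (map (x ,_) ys) h + ∑ (cartesianProduct xs ys) h
    ≡⟨ cong₂ _+_ (∑-map (x ,_) ys h) (∑-cartesianProduct xs ys f g) ⟩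
  ∑ ys (λ y → f x * g y) + ∑ xs f * ∑ ys g
    ≡⟨ cong (_+ ∑ xs f * ∑ ys g) (∑-*ˡ ys g (f x)) ⟨
  f x * ∑ ys g + ∑ xs f * ∑ ys g
    ≡⟨ *-distribʳ (∑ ys g) (f x) (∑ xs f) ⟨
  (f x + ∑ xs f) * ∑ ys g                              ∎
  where
  h : _ × _ → Poly
  h (x′ , y) = f x′ * g y

∑-partition : {A : Set} {P : A → Set} (P? : Decidable P) (xs : List A) (f : A → Poly) →
           ∑ xs f ≡ ∑ (filter P? xs) f + ∑ (filter (¬? ∘ P?) xs) f
∑-partition P? []       f = refl
∑-partition P? (x ∷ xs) f with does (P? x)
... | true  = trans (cong (f x +_) (∑-partition P? xs f)) (sym (+-assoc (f x) _ _))
... | false = trans (cong (f x +_) (∑-partition P? xs f)) (+-swap-left (f x) (∑ (filter P? xs) f) _)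

∑-filter : {A : Set} {P : A → Set} (P? : Decidable P) (xs : List A) (f : A → Poly) →
           ∑ (filter P? xs) f ≡ ∑ xs (λ x → select (does (P? x)) (f x))
∑-filter P? []       f = refl
∑-filter P? (x ∷ xs) f with does (P? x)
... | true  = cong (f x +_) (∑-filter P? xs f)
... | false = ∑-filter P? xs f

Unique-map⁺ : {A B : Set} {f : A → B} {xs : List A} → Unique xs →
              (∀ {x y} → x ∈ xs → y ∈ xs → f x ≡ f y → x ≡ y) → Unique (map f xs)
Unique-map⁺ []                                  _   = []
Unique-map⁺ {f = f} {x ∷ xs} (x∉xs ∷ xs-unique) inj =
  All.tabulate fx≢ ∷ Unique-map⁺ xs-unique (λ x∈ y∈ → inj (there x∈) (there y∈))
  where
  fx≢ : ∀ {z} → z ∈ map f xs → f x ≢ z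
  fx≢ z∈ with y , y∈ , refl ← ∈-map⁻ f z∈ = All.lookup x∉xs y∈ ∘ inj (here refl) (there y∈)

unique∧set⇒↭ : {A : Set} {xs ys : List A} → Unique xs → Unique ys →
               (∀ {x} → x ∈ xs → x ∈ ys) → (∀ {x} → x ∈ ys → x ∈ xs) → xs ↭ ys
unique∧set⇒↭ xs-unique ys-unique ⊆ ⊇ = ∼bag⇒↭ (unique∧set⇒bag xs-unique ys-unique (mk⇔ ⊆ ⊇))

record IsFactorisationList (A : Poly) (L : List (Poly × Poly)) : Set where
  field
    unique   : Unique L
    sound    : ∀ {x} → x ∈ L → proj₁ x * proj₂ x ≡ A
    complete : ∀ {x} → proj₁ x * proj₂ x ≡ A → x ∈ L

∑-factorisations : ∀ {A L M} (f : Poly × Poly → Poly) →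
                   IsFactorisationList A L → IsFactorisationList A M → ∑ L f ≡ ∑ M f
∑-factorisations f L-fact M-fact =
  ∑-↭ f (unique∧set⇒↭ L.unique M.unique (M.complete ∘ L.sound) (L.complete ∘ M.sound))
  where
  module L = IsFactorisationList L-fact
  module M = IsFactorisationList M-fact

infixl 7 _⊗_
_⊗_ : Poly × Poly → Poly × Poly → Poly × Poly
(d₁ , q₁) ⊗ (d₂ , q₂) = d₁ * d₂ , q₁ * q₂

-- Split off the gcd g of D and M: D / g is coprime to M / g, hence divides N.
factorisation-of-product : ∀ {M N D Q} → D * Q ≡ M * N → D ≢ 𝟎 →
  ∃₂ λ x y → proj₁ x * proj₂ x ≡ M × proj₁ y * proj₂ y ≡ N × (D , Q) ≡ x ⊗ y
factorisation-of-product {M} {N} {D} {Q} DQ≡MN D≢𝟎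
  with bézout g u v (D₂ , gD₂≡D) (Q₁ , gQ₁≡M) g≡uD+vM ← bézout-of D M
  = (g , Q₁) , (D₂ , Q₂) , gQ₁≡M , D₂Q₂≡N , cong₂ _,_ (sym gD₂≡D) Q≡Q₁Q₂
  where
  g≢𝟎 : g ≢ 𝟎
  g≢𝟎 = *-≢𝟎⇒≢𝟎ˡ g D₂ (subst (_≢ 𝟎) (sym gD₂≡D) D≢𝟎)
  D₂≢𝟎 : D₂ ≢ 𝟎
  D₂≢𝟎 = *-≢𝟎⇒≢𝟎ʳ g D₂ (subst (_≢ 𝟎) (sym gD₂≡D) D≢𝟎)
  regroup : ∀ g u v d q → g * (u * d + v * q) ≡ u * (g * d) + v * (g * q)
  regroup = solve-∀ ring
  D₂⊥Q₁ : Coprime D₂ Q₁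
  D₂⊥Q₁ = bézout⇒Coprime u v (*-cancelˡ g g≢𝟎 (begin
    g * (u * D₂ + v * Q₁)       ≡⟨ regroup g u v D₂ Q₁ ⟩
    u * (g * D₂) + v * (g * Q₁) ≡⟨ cong₂ (λ a b → u * a + v * b) gD₂≡D gQ₁≡M ⟩
    u * D + v * M               ≡⟨ g≡uD+vM ⟨
    g                           ≡⟨ *-identityʳ g ⟨
    g * 𝟏                       ∎))
  D₂Q≡Q₁N : D₂ * Q ≡ Q₁ * N
  D₂Q≡Q₁N = *-cancelˡ g g≢𝟎 (begin
    g * (D₂ * Q)   ≡⟨ *-assoc g D₂ Q ⟨
    (g * D₂) * Q   ≡⟨ cong (_* Q) gD₂≡D ⟩
    D * Q          ≡⟨ DQ≡MN ⟩
    M * N          ≡⟨ cong (_* N) gQ₁≡M ⟨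
    (g * Q₁) * N   ≡⟨ *-assoc g Q₁ N ⟩
    g * (Q₁ * N)   ∎)
  D₂∣N : D₂ ∣ N
  D₂∣N = coprime-divisor D₂⊥Q₁ (Q , D₂Q≡Q₁N)
  Q₂ = proj₁ D₂∣N
  D₂Q₂≡N : D₂ * Q₂ ≡ N
  D₂Q₂≡N = proj₂ D₂∣N
  Q≡Q₁Q₂ : Q ≡ Q₁ * Q₂
  Q≡Q₁Q₂ = *-cancelˡ D₂ D₂≢𝟎 (begin
    D₂ * Q           ≡⟨ D₂Q≡Q₁N ⟩
    Q₁ * N           ≡⟨ cong (Q₁ *_) D₂Q₂≡N ⟨
    Q₁ * (D₂ * Q₂)   ≡⟨ *-swap-left Q₁ D₂ Q₂ ⟩
    D₂ * (Q₁ * Q₂)   ∎)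

⊗-injective : ∀ {M N} → Coprime M N → M ≢ 𝟎 → N ≢ 𝟎 → ∀ d₁ q₁ d₂ q₂ d₁′ q₁′ d₂′ q₂′ →
  d₁ * q₁ ≡ M → d₁′ * q₁′ ≡ M → d₂ * q₂ ≡ N → d₂′ * q₂′ ≡ N →
  (d₁ , q₁) ⊗ (d₂ , q₂) ≡ (d₁′ , q₁′) ⊗ (d₂′ , q₂′) →
  (d₁ , q₁) ≡ (d₁′ , q₁′) × (d₂ , q₂) ≡ (d₂′ , q₂′)
⊗-injective {M} {N} M⊥N M≢𝟎 N≢𝟎 d₁ q₁ d₂ q₂ d₁′ q₁′ d₂′ q₂′ e₁ e₁′ e₂ e₂′ eq =
  cong₂ _,_ d₁≡d₁′ q₁≡q₁′ , cong₂ _,_ d₂≡d₂′ q₂≡q₂′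
  where
  d₁d₂≡ : d₁ * d₂ ≡ d₁′ * d₂′
  d₁d₂≡ = cong proj₁ eq
  d₁≢𝟎 : d₁ ≢ 𝟎
  d₁≢𝟎 = ∣⇒≢𝟎 (q₁ , e₁) M≢𝟎
  d₁∣d₁′ : d₁ ∣ d₁′
  d₁∣d₁′ = coprime-divisor {d₁} {d₂′} (Coprime-∣ M⊥N (q₁ , e₁) (q₂′ , e₂′))
                           (d₂ , trans d₁d₂≡ (*-comm d₁′ d₂′))
  d₁′∣d₁ : d₁′ ∣ d₁
  d₁′∣d₁ = coprime-divisor {d₁′} {d₂} (Coprime-∣ M⊥N (q₁′ , e₁′) (q₂ , e₂))
                           (d₂′ , trans (sym d₁d₂≡) (*-comm d₁ d₂))
  d₁≡d₁′ : d₁ ≡ d₁′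
  d₁≡d₁′ = ∣-antisym d₁∣d₁′ d₁′∣d₁ d₁≢𝟎
  q₁≡q₁′ : q₁ ≡ q₁′
  q₁≡q₁′ = *-cancelˡ d₁ d₁≢𝟎 (trans e₁ (trans (sym e₁′) (cong (_* q₁′) (sym d₁≡d₁′))))
  d₂≡d₂′ : d₂ ≡ d₂′
  d₂≡d₂′ = *-cancelˡ d₁ d₁≢𝟎 (trans d₁d₂≡ (cong (_* d₂′) (sym d₁≡d₁′)))
  d₂≢𝟎 : d₂ ≢ 𝟎
  d₂≢𝟎 = ∣⇒≢𝟎 (q₂ , e₂) N≢𝟎
  q₂≡q₂′ : q₂ ≡ q₂′
  q₂≡q₂′ = *-cancelˡ d₂ d₂≢𝟎 (trans e₂ (trans (sym e₂′) (cong (_* q₂′) (sym d₂≡d₂′))))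

productFactorisations : List (Poly × Poly) → List (Poly × Poly) → List (Poly × Poly)
productFactorisations L₁ L₂ = map (uncurry _⊗_) (cartesianProduct L₁ L₂)

productFactorisations-isFactorisationList : ∀ {M N L₁ L₂} → Coprime M N → M ≢ 𝟎 → N ≢ 𝟎 →
  IsFactorisationList M L₁ → IsFactorisationList N L₂ → IsFactorisationList (M * N) (productFactorisations L₁ L₂)
productFactorisations-isFactorisationList {M} {N} {L₁} {L₂} M⊥N M≢𝟎 N≢𝟎 L₁-fact L₂-fact = record
  { unique   = Unique-map⁺ (Unique.cartesianProduct⁺ L₁.unique L₂.unique) injective
  ; sound    = sound
  ; complete = complete }
  where
  module L₁ = IsFactorisationList L₁-fact
  module L₂ = IsFactorisationList L₂-fact
  sound : ∀ {x} → x ∈ productFactorisations L₁ L₂ → proj₁ x * proj₂ x ≡ M * N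
  sound x∈ with ((d₁ , q₁) , (d₂ , q₂)) , xy∈ , refl ← ∈-map⁻ (uncurry _⊗_) x∈
    with x∈L₁ , y∈L₂ ← ∈-cartesianProduct⁻ L₁ L₂ xy∈
    = trans (*-interchange d₁ d₂ q₁ q₂) (cong₂ _*_ (L₁.sound x∈L₁) (L₂.sound y∈L₂))
  complete : ∀ {x} → proj₁ x * proj₂ x ≡ M * N → x ∈ productFactorisations L₁ L₂
  complete {D , Q} DQ≡MN =
    from-split (factorisation-of-product DQ≡MN (∣⇒≢𝟎 {D} (Q , DQ≡MN) (*-≢𝟎 M≢𝟎 N≢𝟎)))
    where
    from-split : (∃₂ λ x y → proj₁ x * proj₂ x ≡ M × proj₁ y * proj₂ y ≡ N × (D , Q) ≡ x ⊗ y) →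
                 (D , Q) ∈ productFactorisations L₁ L₂
    from-split (x , y , x-fact , y-fact , D,Q≡x⊗y) = subst (_∈ productFactorisations L₁ L₂) (sym D,Q≡x⊗y)
      (∈-map⁺ (uncurry _⊗_) (∈-cartesianProduct⁺ (L₁.complete {x} x-fact) (L₂.complete {y} y-fact)))
  injective : ∀ {p p′} → p ∈ cartesianProduct L₁ L₂ → p′ ∈ cartesianProduct L₁ L₂ →
              uncurry _⊗_ p ≡ uncurry _⊗_ p′ → p ≡ p′
  injective {(d₁ , q₁) , (d₂ , q₂)} {(d₁′ , q₁′) , (d₂′ , q₂′)} p∈ p′∈ eq =
    let (x∈ , y∈) = ∈-cartesianProduct⁻ L₁ L₂ p∈
        (x′∈ , y′∈) = ∈-cartesianProduct⁻ L₁ L₂ p′∈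
        (x≡x′ , y≡y′) = ⊗-injective M⊥N M≢𝟎 N≢𝟎 d₁ q₁ d₂ q₂ d₁′ q₁′ d₂′ q₂′
                          (L₁.sound x∈) (L₁.sound x′∈) (L₂.sound y∈) (L₂.sound y′∈) eq
    in cong₂ _,_ x≡x′ y≡y′

allP⁺-unique : ∀ n → Unique (allP⁺ n)
allP⁺-unique zero    = All.[] ∷ []
allP⁺-unique (suc n) = All.tabulate one∉ ∷ Unique.++⁺ (Unique.map⁺ ∷⁺-injective (allP⁺-unique n))
                                                      (Unique.map⁺ ∷⁺-injective (allP⁺-unique n)) disjoint
  where
  ∷⁺-injective : ∀ {b p q} → b ∷⁺ p ≡ b ∷⁺ q → p ≡ q
  ∷⁺-injective refl = refl
  one∉ : ∀ {p} → p ∈ map (false ∷⁺_) (allP⁺ n) ++ map (true ∷⁺_) (allP⁺ n) → one ≢ p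
  one∉ p∈ with ∈-++⁻ (map (false ∷⁺_) (allP⁺ n)) p∈
  ... | inj₁ p∈ˡ with _ , _ , refl ← ∈-map⁻ (false ∷⁺_) p∈ˡ = λ ()
  ... | inj₂ p∈ʳ with _ , _ , refl ← ∈-map⁻ (true ∷⁺_) p∈ʳ = λ ()
  disjoint : ∀ {p} → ¬ (p ∈ map (false ∷⁺_) (allP⁺ n) × p ∈ map (true ∷⁺_) (allP⁺ n))
  disjoint (p∈ˡ , p∈ʳ)
    with _ , _ , refl ← ∈-map⁻ (false ∷⁺_) p∈ˡ with _ , _ , () ← ∈-map⁻ (true ∷⁺_) p∈ʳ

module _ (A : Poly) where

  ∈-mapMaybe-pairOf⁻ : ∀ ds {x} → x ∈ mapMaybe (pairOf A) ds → nz (proj₁ x) * proj₂ x ≡ A × proj₁ x ∈ ds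
  ∈-mapMaybe-pairOf⁻ (d ∷ ds) x∈ with nz d ∣? A
  ∈-mapMaybe-pairOf⁻ (d ∷ ds) (here refl) | yes (q , dq≡A) = dq≡A , here refl
  ∈-mapMaybe-pairOf⁻ (d ∷ ds) (there x∈)  | yes _ = Product.map₂ there (∈-mapMaybe-pairOf⁻ ds x∈)
  ∈-mapMaybe-pairOf⁻ (d ∷ ds) x∈          | no _  = Product.map₂ there (∈-mapMaybe-pairOf⁻ ds x∈)

  ∈-mapMaybe-pairOf⁺ : ∀ ds {d q} → d ∈ ds → nz d * q ≡ A → (d , q) ∈ mapMaybe (pairOf A) ds
  ∈-mapMaybe-pairOf⁺ (d ∷ ds) (here refl) dq≡A with nz d ∣? A
  ... | yes (q′ , dq′≡A) = here (cong (d ,_) (*-cancelˡ (nz d) (nz≢𝟎 d) (trans dq≡A (sym dq′≡A))))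
  ... | no d∤A           = ⊥-elim (d∤A (_ , dq≡A))
  ∈-mapMaybe-pairOf⁺ (d′ ∷ ds) (there d∈) dq≡A with nz d′ ∣? A
  ... | yes _ = there (∈-mapMaybe-pairOf⁺ ds d∈ dq≡A)
  ... | no _  = ∈-mapMaybe-pairOf⁺ ds d∈ dq≡A

  mapMaybe-pairOf-unique : ∀ {ds} → Unique ds → Unique (mapMaybe (pairOf A) ds)
  mapMaybe-pairOf-unique {[]}     _                 = []
  mapMaybe-pairOf-unique {d ∷ ds} (d∉ds ∷ ds-unique) with nz d ∣? A
  ... | yes _ = All.tabulate (λ x∈ → λ { refl → All.lookup d∉ds (proj₂ (∈-mapMaybe-pairOf⁻ ds x∈)) refl })
                ∷ mapMaybe-pairOf-unique ds-unique
  ... | no _  = mapMaybe-pairOf-unique ds-unique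

factorisations : Poly → List (Poly × Poly)
factorisations A = map (λ (d , q) → nz d , q) (divisorPairs A)

divisorPairs-unique : ∀ A → Unique (divisorPairs A)
divisorPairs-unique 𝟎      = []
divisorPairs-unique (nz a) = mapMaybe-pairOf-unique (nz a) (allP⁺-unique (deg a))

∈-divisorPairs⁻ : ∀ A {x} → x ∈ divisorPairs A → nz (proj₁ x) * proj₂ x ≡ A
∈-divisorPairs⁻ (nz a) x∈ = proj₁ (∈-mapMaybe-pairOf⁻ (nz a) (allP⁺ (deg a)) x∈)

∈-divisorPairs⁺ : ∀ a {d q} → nz d * q ≡ nz a → (d , q) ∈ divisorPairs (nz a)
∈-divisorPairs⁺ a {d} {q} dq≡a =
  ∈-mapMaybe-pairOf⁺ (nz a) (allP⁺ (deg a)) (allP⁺-complete d (deg a) (∣-deg d a (q , dq≡a))) dq≡a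

factorisations-isFactorisationList : ∀ {A} → A ≢ 𝟎 → IsFactorisationList A (factorisations A)
factorisations-isFactorisationList {𝟎}    A≢𝟎 = ⊥-elim (A≢𝟎 refl)
factorisations-isFactorisationList {nz a} _   = record
  { unique   = Unique.map⁺ nz-injective (divisorPairs-unique (nz a))
  ; sound    = sound
  ; complete = complete }
  where
  nz-injective : ∀ {x y : P⁺ × Poly} → (nz (proj₁ x) , proj₂ x) ≡ (nz (proj₁ y) , proj₂ y) → x ≡ y
  nz-injective refl = refl
  sound : ∀ {x} → x ∈ factorisations (nz a) → proj₁ x * proj₂ x ≡ nz a
  sound x∈ with _ , y∈ , refl ← ∈-map⁻ _ x∈ = ∈-divisorPairs⁻ (nz a) y∈
  complete : ∀ {x} → proj₁ x * proj₂ x ≡ nz a → x ∈ factorisations (nz a)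
  complete {nz d , q} dq≡a = ∈-map⁺ _ (∈-divisorPairs⁺ a dq≡a)

Multiplicative : (Poly → Poly) → Set
Multiplicative f = ∀ {M N} → Coprime M N → M ≢ 𝟎 → N ≢ 𝟎 → f (M * N) ≡ f M * f N

divisorSum : (Poly × Poly → Poly) → Poly → Poly
divisorSum f A = ∑ (factorisations A) f

divisorSum-multiplicative : (f : Poly × Poly → Poly) →
  (∀ d₁ q₁ d₂ q₂ → Coprime (d₁ * q₁) (d₂ * q₂) → d₁ * q₁ ≢ 𝟎 → d₂ * q₂ ≢ 𝟎 →
     f ((d₁ , q₁) ⊗ (d₂ , q₂)) ≡ f (d₁ , q₁) * f (d₂ , q₂)) →
  Multiplicative (divisorSum f)
divisorSum-multiplicative f f-⊗ {M} {N} M⊥N M≢𝟎 N≢𝟎 = begin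
  ∑ (factorisations (M * N)) f
    ≡⟨ ∑-factorisations f (factorisations-isFactorisationList (*-≢𝟎 M≢𝟎 N≢𝟎)) LM×LN-fact ⟩
  ∑ (productFactorisations LM LN) f
    ≡⟨ ∑-map (uncurry _⊗_) (cartesianProduct LM LN) f ⟩
  ∑ (cartesianProduct LM LN) (λ (x , y) → f (x ⊗ y))
    ≡⟨ ∑-cong (cartesianProduct LM LN) ⊗-case ⟩
  ∑ (cartesianProduct LM LN) (λ (x , y) → f x * f y)
    ≡⟨ ∑-cartesianProduct LM LN f f ⟩
  ∑ LM f * ∑ LN f                                      ∎
  where
  LM = factorisations M
  LN = factorisations N
  LM-fact = factorisations-isFactorisationList M≢𝟎
  LN-fact = factorisations-isFactorisationList N≢𝟎
  LM×LN-fact = productFactorisations-isFactorisationList M⊥N M≢𝟎 N≢𝟎 LM-fact LN-fact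
  ⊗-case : ∀ {p} → p ∈ cartesianProduct LM LN → f (proj₁ p ⊗ proj₂ p) ≡ f (proj₁ p) * f (proj₂ p)
  ⊗-case {(d₁ , q₁) , (d₂ , q₂)} p∈ with x∈ , y∈ ← ∈-cartesianProduct⁻ LM LN p∈ =
    f-⊗ d₁ q₁ d₂ q₂ (subst₂ Coprime (sym x≡) (sym y≡) M⊥N)
                    (subst (_≢ 𝟎) (sym x≡) M≢𝟎) (subst (_≢ 𝟎) (sym y≡) N≢𝟎)
    where
    x≡ = IsFactorisationList.sound LM-fact x∈
    y≡ = IsFactorisationList.sound LN-fact y∈

infixl 7 _⋆_
_⋆_ : (Poly → Poly) → (Poly → Poly) → Poly → Poly
(f ⋆ g) = divisorSum (λ (d , q) → f d * g q)

⋆-multiplicative : ∀ {f g} → Multiplicative f → Multiplicative g → Multiplicative (f ⋆ g)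
⋆-multiplicative {f} {g} f-mult g-mult = divisorSum-multiplicative _ ⊗-case
  where
  ⊗-case : ∀ d₁ q₁ d₂ q₂ → Coprime (d₁ * q₁) (d₂ * q₂) → d₁ * q₁ ≢ 𝟎 → d₂ * q₂ ≢ 𝟎 →
           f (d₁ * d₂) * g (q₁ * q₂) ≡ (f d₁ * g q₁) * (f d₂ * g q₂)
  ⊗-case d₁ q₁ d₂ q₂ d₁q₁⊥d₂q₂ d₁q₁≢𝟎 d₂q₂≢𝟎 = begin
    f (d₁ * d₂) * g (q₁ * q₂)       ≡⟨ cong₂ _*_ f-d₁d₂ g-q₁q₂ ⟩
    (f d₁ * f d₂) * (g q₁ * g q₂)   ≡⟨ *-interchange (f d₁) (f d₂) (g q₁) (g q₂) ⟩
    (f d₁ * g q₁) * (f d₂ * g q₂)   ∎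
    where
    f-d₁d₂ = f-mult (Coprime-∣ d₁q₁⊥d₂q₂ (m∣m*n d₁ q₁) (m∣m*n d₂ q₂))
                    (*-≢𝟎⇒≢𝟎ˡ d₁ q₁ d₁q₁≢𝟎) (*-≢𝟎⇒≢𝟎ˡ d₂ q₂ d₂q₂≢𝟎)
    g-q₁q₂ = g-mult (Coprime-∣ d₁q₁⊥d₂q₂ (n∣m*n d₁ q₁) (n∣m*n d₂ q₂))
                    (*-≢𝟎⇒≢𝟎ʳ d₁ q₁ d₁q₁≢𝟎) (*-≢𝟎⇒≢𝟎ʳ d₂ q₂ d₂q₂≢𝟎)

Multiplicative-resp-≗ : ∀ {f g} → (∀ A → f A ≡ g A) → Multiplicative g → Multiplicative f
Multiplicative-resp-≗ {f} {g} f≗g g-mult {M} {N} M⊥N M≢𝟎 N≢𝟎 =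
  trans (f≗g (M * N)) (trans (g-mult M⊥N M≢𝟎 N≢𝟎) (sym (cong₂ _*_ (f≗g M) (f≗g N))))

σ≡id⋆𝟏 : ∀ A → σ A ≡ ((λ D → D) ⋆ (λ _ → 𝟏)) A
σ≡id⋆𝟏 A = sym (trans (∑-map (λ (d , q) → nz d , q) (divisorPairs A) _)
                      (∑-cong (divisorPairs A) λ {x} _ → *-identityʳ (nz (proj₁ x))))

σ-multiplicative : Multiplicative σ
σ-multiplicative =
  Multiplicative-resp-≗ σ≡id⋆𝟏 (⋆-multiplicative {λ D → D} {λ _ → 𝟏} (λ _ _ _ → refl) (λ _ _ _ → refl))

unitaryPart : Poly × Poly → Poly
unitaryPart (𝟎    , q) = 𝟎
unitaryPart (nz d , q) = select (does (Coprime? d q)) (nz d)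

σ*≡divisorSum-unitaryPart : ∀ A → σ* A ≡ divisorSum unitaryPart A
σ*≡divisorSum-unitaryPart A = trans (∑-filter IsUnitary? (divisorPairs A) (λ x → nz (proj₁ x)))
                                    (sym (∑-map (λ (d , q) → nz d , q) (divisorPairs A) unitaryPart))

unitaryPart-coprime : ∀ {D Q} → D ≢ 𝟎 → Coprime D Q → unitaryPart (D , Q) ≡ D
unitaryPart-coprime {𝟎}    D≢𝟎 _ = ⊥-elim (D≢𝟎 refl)
unitaryPart-coprime {nz d} {Q} _ d⊥Q with Coprime? d Q
... | yes _   = refl
... | no d⊥̸Q = ⊥-elim (d⊥̸Q d⊥Q)

unitaryPart-¬coprime : ∀ {D Q} → ¬ Coprime D Q → unitaryPart (D , Q) ≡ 𝟎
unitaryPart-¬coprime {𝟎}    _    = refl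
unitaryPart-¬coprime {nz d} {Q} d⊥̸Q with Coprime? d Q
... | yes d⊥Q = ⊥-elim (d⊥̸Q d⊥Q)
... | no _    = refl

Coprime-dec : ∀ {D} Q → D ≢ 𝟎 → Dec (Coprime D Q)
Coprime-dec {𝟎}    Q D≢𝟎 = ⊥-elim (D≢𝟎 refl)
Coprime-dec {nz d} Q _   = Coprime? d Q

Coprime-⊗ : ∀ {d₁ q₁ d₂ q₂} → Coprime (d₁ * q₁) (d₂ * q₂) → Coprime d₁ q₁ → Coprime d₂ q₂ →
            Coprime (d₁ * d₂) (q₁ * q₂)
Coprime-⊗ {d₁} {q₁} {d₂} {q₂} d₁q₁⊥d₂q₂ d₁⊥q₁ d₂⊥q₂ =
  Coprime-*ˡ (Coprime-*ʳ d₁⊥q₁ (Coprime-∣ d₁q₁⊥d₂q₂ (m∣m*n d₁ q₁) (n∣m*n d₂ q₂)))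
             (Coprime-*ʳ {d₂} {q₁} (Coprime-sym (Coprime-∣ d₁q₁⊥d₂q₂ (n∣m*n d₁ q₁) (m∣m*n d₂ q₂)))
                                   d₂⊥q₂)

Coprime-⊗⁻ : ∀ {d₁ q₁ d₂ q₂} → Coprime (d₁ * d₂) (q₁ * q₂) → Coprime d₁ q₁ × Coprime d₂ q₂
Coprime-⊗⁻ {d₁} {q₁} {d₂} {q₂} d₁d₂⊥q₁q₂ =
  Coprime-∣ d₁d₂⊥q₁q₂ (m∣m*n d₁ d₂) (m∣m*n q₁ q₂) ,
  Coprime-∣ d₁d₂⊥q₁q₂ (n∣m*n d₁ d₂) (n∣m*n q₁ q₂)

σ*-multiplicative : Multiplicative σ*
σ*-multiplicative =
  Multiplicative-resp-≗ σ*≡divisorSum-unitaryPart (divisorSum-multiplicative unitaryPart ⊗-case)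
  where
  ⊗-case : ∀ d₁ q₁ d₂ q₂ → Coprime (d₁ * q₁) (d₂ * q₂) → d₁ * q₁ ≢ 𝟎 → d₂ * q₂ ≢ 𝟎 →
           unitaryPart (d₁ * d₂ , q₁ * q₂) ≡ unitaryPart (d₁ , q₁) * unitaryPart (d₂ , q₂)
  ⊗-case d₁ q₁ d₂ q₂ d₁q₁⊥d₂q₂ d₁q₁≢𝟎 d₂q₂≢𝟎
    with Coprime-dec q₁ (*-≢𝟎⇒≢𝟎ˡ d₁ q₁ d₁q₁≢𝟎) | Coprime-dec q₂ (*-≢𝟎⇒≢𝟎ˡ d₂ q₂ d₂q₂≢𝟎)
  ... | yes d₁⊥q₁ | yes d₂⊥q₂ = begin
    unitaryPart (d₁ * d₂ , q₁ * q₂)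
      ≡⟨ unitaryPart-coprime (*-≢𝟎 d₁≢𝟎 d₂≢𝟎) (Coprime-⊗ d₁q₁⊥d₂q₂ d₁⊥q₁ d₂⊥q₂) ⟩
    d₁ * d₂
      ≡⟨ cong₂ _*_ (unitaryPart-coprime d₁≢𝟎 d₁⊥q₁) (unitaryPart-coprime d₂≢𝟎 d₂⊥q₂) ⟨
    unitaryPart (d₁ , q₁) * unitaryPart (d₂ , q₂)  ∎
    where
    d₁≢𝟎 = *-≢𝟎⇒≢𝟎ˡ d₁ q₁ d₁q₁≢𝟎
    d₂≢𝟎 = *-≢𝟎⇒≢𝟎ˡ d₂ q₂ d₂q₂≢𝟎
  ... | no d₁⊥̸q₁ | _ = begin
    unitaryPart (d₁ * d₂ , q₁ * q₂)
      ≡⟨ unitaryPart-¬coprime (d₁⊥̸q₁ ∘ proj₁ ∘ Coprime-⊗⁻ {d₁} {q₁} {d₂} {q₂}) ⟩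
    𝟎
      ≡⟨ cong (_* unitaryPart (d₂ , q₂)) (unitaryPart-¬coprime d₁⊥̸q₁) ⟨
    unitaryPart (d₁ , q₁) * unitaryPart (d₂ , q₂)  ∎
  ... | yes _ | no d₂⊥̸q₂ = begin
    unitaryPart (d₁ * d₂ , q₁ * q₂)
      ≡⟨ unitaryPart-¬coprime (d₂⊥̸q₂ ∘ proj₂ ∘ Coprime-⊗⁻ {d₁} {q₁} {d₂} {q₂}) ⟩
    𝟎
      ≡⟨ *-𝟎 (unitaryPart (d₁ , q₁)) ⟨
    unitaryPart (d₁ , q₁) * 𝟎
      ≡⟨ cong (unitaryPart (d₁ , q₁) *_) (unitaryPart-¬coprime d₂⊥̸q₂) ⟨
    unitaryPart (d₁ , q₁) * unitaryPart (d₂ , q₂)  ∎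

-- Prime powers

^-+ : ∀ P m n → P ^ (m +ℕ n) ≡ P ^ m * P ^ n
^-+ P zero    n = refl
^-+ P (suc m) n = trans (cong (P *_) (^-+ P m n)) (sym (*-assoc P (P ^ m) (P ^ n)))

^-≢𝟎 : ∀ {P} n → P ≢ 𝟎 → P ^ n ≢ 𝟎
^-≢𝟎 zero    _   ()
^-≢𝟎 (suc n) P≢𝟎 = *-≢𝟎 P≢𝟎 (^-≢𝟎 n P≢𝟎)

degP-^ : ∀ {P} n → P ≢ 𝟎 → degP (P ^ n) ≡ n *ℕ degP P
degP-^ zero    _   = refl
degP-^ (suc n) P≢𝟎 = trans (degP-* P≢𝟎 (^-≢𝟎 n P≢𝟎)) (cong (_ +ℕ_) (degP-^ n P≢𝟎))

^-injective : ∀ {P m n} → 1 ≤ degP P → P ^ m ≡ P ^ n → m ≡ n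
^-injective {𝟎}    ()
^-injective {nz p} {m} {n} 1≤deg e with deg p | degP-^ m (nz≢𝟎 p) | degP-^ n (nz≢𝟎 p)
... | suc d | deg-m | deg-n = ℕ.*-cancelʳ-≡ m n (suc d) (trans (sym deg-m) (trans (cong degP e) deg-n))

splits : ℕ → List (ℕ × ℕ)
splits zero    = (0 , 0) ∷ []
splits (suc n) = (0 , suc n) ∷ map (Product.map₁ suc) (splits n)

∈-splits⁻ : ∀ {n i j} → (i , j) ∈ splits n → i +ℕ j ≡ n
∈-splits⁻ {zero}  (here refl) = refl
∈-splits⁻ {suc n} (here refl) = refl
∈-splits⁻ {suc n} (there ij∈) with (i , j) , i′j∈ , refl ← ∈-map⁻ (Product.map₁ suc) ij∈ =
  cong suc (∈-splits⁻ i′j∈)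

∈-splits⁺ : ∀ {n} i j → i +ℕ j ≡ n → (i , j) ∈ splits n
∈-splits⁺ {zero}  zero    zero    _  = here refl
∈-splits⁺ {suc n} zero    j       refl = here refl
∈-splits⁺ {suc n} (suc i) j       e  = there (∈-map⁺ (Product.map₁ suc) (∈-splits⁺ i j (ℕ.suc-injective e)))

splits-unique : ∀ n → Unique (splits n)
splits-unique zero    = All.[] ∷ []
splits-unique (suc n) = All.tabulate 0∉ ∷ Unique.map⁺ map₁-suc-injective (splits-unique n)
  where
  map₁-suc-injective : ∀ {x y : ℕ × ℕ} → Product.map₁ suc x ≡ Product.map₁ suc y → x ≡ y
  map₁-suc-injective refl = refl
  0∉ : ∀ {x} → x ∈ map (Product.map₁ suc) (splits n) → (0 , suc n) ≢ x
  0∉ x∈ with _ , _ , refl ← ∈-map⁻ (Product.map₁ suc) x∈ = λ ()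

∑-splits-suc : ∀ n (h : ℕ × ℕ → Poly) →
               ∑ (splits (suc n)) h ≡ h (0 , suc n) + ∑ (splits n) (λ (i , j) → h (suc i , j))
∑-splits-suc n h = cong (h (0 , suc n) +_) (∑-map (Product.map₁ suc) (splits n) h)

∑-splits-last : ∀ n (h : ℕ × ℕ → Poly) → (∀ i j → h (i , suc j) ≡ 𝟎) → ∑ (splits n) h ≡ h (n , 0)
∑-splits-last zero    h h≡𝟎 = +-identityʳ (h (0 , 0))
∑-splits-last (suc n) h h≡𝟎 = begin
  ∑ (splits (suc n)) h
    ≡⟨ ∑-splits-suc n h ⟩
  h (0 , suc n) + ∑ (splits n) (λ (i , j) → h (suc i , j))
    ≡⟨ cong₂ _+_ (h≡𝟎 0 n) (∑-splits-last n _ (λ i j → h≡𝟎 (suc i) j)) ⟩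
  𝟎 + h (suc n , 0)                                          ∎

module _ {P : Poly} (P-irr : Irreducible P) where

  Irreducible⇒≢𝟎 : P ≢ 𝟎
  Irreducible⇒≢𝟎 refl with () ← proj₁ P-irr

  Irreducible⇒≢𝟏 : P ≢ 𝟏
  Irreducible⇒≢𝟏 refl with () ← proj₁ P-irr

  Irreducible⇒Coprime : ∀ {D} → ¬ P ∣ D → Coprime P D
  Irreducible⇒Coprime P∤D E E∣P E∣D with proj₂ P-irr E E∣P
  ... | inj₁ E≡𝟏 = E≡𝟏
  ... | inj₂ refl = ⊥-elim (P∤D E∣D)

  factorisation-of-power : ∀ n {D Q} → D * Q ≡ P ^ n →
                           ∃₂ λ i j → i +ℕ j ≡ n × (D , Q) ≡ (P ^ i , P ^ j)
  factorisation-of-power zero {D} {Q} DQ≡𝟏 =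
    0 , 0 , refl , cong₂ _,_ (*≡𝟏⇒≡𝟏 D Q DQ≡𝟏) (*≡𝟏⇒≡𝟏 Q D (trans (*-comm Q D) DQ≡𝟏))
  factorisation-of-power (suc n) {D} {Q} DQ≡P^n+1 with P ∣? D
  ... | yes (D′ , refl)
    with i , j , i+j≡n , refl ← factorisation-of-power n {D′} {Q}
           (*-cancelˡ P Irreducible⇒≢𝟎 (trans (sym (*-assoc P D′ Q)) DQ≡P^n+1))
    = suc i , j , cong suc i+j≡n , refl
  ... | no P∤D with Q′ , DQ′≡P^n ← coprime-divisor (Coprime-sym (Irreducible⇒Coprime P∤D)) (Q , DQ≡P^n+1)
                 with factorisation-of-power n {D} {Q′} DQ′≡P^n
  ...   | zero  , j , _ , refl = 0 , suc n , refl , cong (𝟏 ,_) DQ≡P^n+1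
  ...   | suc i , _ , _ , refl = ⊥-elim (P∤D (m∣m*n P (P ^ i)))

  powerFactorisations : ℕ → List (Poly × Poly)
  powerFactorisations n = map (λ (i , j) → P ^ i , P ^ j) (splits n)

  powerFactorisations-isFactorisationList : ∀ n → IsFactorisationList (P ^ n) (powerFactorisations n)
  powerFactorisations-isFactorisationList n = record
    { unique   = Unique-map⁺ (splits-unique n) injective
    ; sound    = sound
    ; complete = complete }
    where
    injective : ∀ {x y} → x ∈ splits n → y ∈ splits n →
                (P ^ proj₁ x , P ^ proj₂ x) ≡ (P ^ proj₁ y , P ^ proj₂ y) → x ≡ y
    injective _ _ e =
      cong₂ _,_ (^-injective (proj₁ P-irr) (cong proj₁ e)) (^-injective (proj₁ P-irr) (cong proj₂ e))
    sound : ∀ {x} → x ∈ powerFactorisations n → proj₁ x * proj₂ x ≡ P ^ n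
    sound x∈ with (i , j) , ij∈ , refl ← ∈-map⁻ _ x∈ = trans (sym (^-+ P i j)) (cong (P ^_) (∈-splits⁻ ij∈))
    complete : ∀ {x} → proj₁ x * proj₂ x ≡ P ^ n → x ∈ powerFactorisations n
    complete {D , Q} DQ≡P^n with i , j , i+j≡n , refl ← factorisation-of-power n {D} {Q} DQ≡P^n =
      ∈-map⁺ _ (∈-splits⁺ i j i+j≡n)

  divisorSum-power : ∀ n (f : Poly × Poly → Poly) →
                     divisorSum f (P ^ n) ≡ ∑ (splits n) (λ (i , j) → f (P ^ i , P ^ j))
  divisorSum-power n f = trans (∑-factorisations f (factorisations-isFactorisationList (^-≢𝟎 n Irreducible⇒≢𝟎))
                                                   (powerFactorisations-isFactorisationList n))
                               (∑-map _ (splits n) f)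

  𝟏+P∣σ[P^odd] : ∀ n → parity n ≡ 1ℙ → (𝟏 + P) ∣ σ (P ^ n)
  𝟏+P∣σ[P^odd] n n-odd = subst ((𝟏 + P) ∣_) (sym σ[P^n]≡) (𝟏+P∣geometric n n-odd)
    where
    geometric : ℕ → Poly
    geometric n = ∑ (splits n) (λ (i , j) → P ^ i * 𝟏)
    σ[P^n]≡ : σ (P ^ n) ≡ geometric n
    σ[P^n]≡ = trans (σ≡id⋆𝟏 (P ^ n)) (divisorSum-power n _)
    geometric-suc : ∀ n → geometric (suc n) ≡ 𝟏 + P * geometric n
    geometric-suc n = begin
      geometric (suc n)
        ≡⟨ ∑-splits-suc n (λ (i , j) → P ^ i * 𝟏) ⟩
      𝟏 + ∑ (splits n) (λ (i , j) → (P * P ^ i) * 𝟏)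
        ≡⟨ cong (𝟏 +_) (∑-cong (splits n) λ {x} _ → *-assoc P (P ^ proj₁ x) 𝟏) ⟩
      𝟏 + ∑ (splits n) (λ (i , j) → P * (P ^ i * 𝟏))
        ≡⟨ cong (𝟏 +_) (∑-*ˡ (splits n) (λ (i , j) → P ^ i * 𝟏) P) ⟨
      𝟏 + P * geometric n                             ∎
    𝟏+P∣geometric : ∀ n → parity n ≡ 1ℙ → (𝟏 + P) ∣ geometric n
    𝟏+P∣geometric (suc zero)    _ =
      𝟏 , trans (*-identityʳ (𝟏 + P)) (sym (trans (geometric-suc 0) (cong (𝟏 +_) (*-identityʳ P))))
    𝟏+P∣geometric (suc (suc n)) n-odd with q , [𝟏+P]q≡ ← 𝟏+P∣geometric n n-odd = 𝟏 + P * (P * q) , (begin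
      (𝟏 + P) * (𝟏 + P * (P * q))          ≡⟨ expand P q ⟩
      𝟏 + P * (𝟏 + P * ((𝟏 + P) * q))      ≡⟨ cong (λ z → 𝟏 + P * (𝟏 + P * z)) [𝟏+P]q≡ ⟩
      𝟏 + P * (𝟏 + P * geometric n)        ≡⟨ cong (λ z → 𝟏 + P * z) (geometric-suc n) ⟨
      𝟏 + P * geometric (suc n)            ≡⟨ geometric-suc (suc n) ⟨
      geometric (suc (suc n))              ∎)
      where
      expand : ∀ P q → (𝟏 + P) * (𝟏 + P * (P * q)) ≡ 𝟏 + P * (𝟏 + P * ((𝟏 + P) * q))
      expand = solve-∀ ring

  σ*[P^n+1] : ∀ n → σ* (P ^ suc n) ≡ 𝟏 + P ^ suc n
  σ*[P^n+1] n = begin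
    σ* (P ^ suc n)
      ≡⟨ σ*≡divisorSum-unitaryPart (P ^ suc n) ⟩
    divisorSum unitaryPart (P ^ suc n)
      ≡⟨ divisorSum-power (suc n) unitaryPart ⟩
    ∑ (splits (suc n)) (λ (i , j) → unitaryPart (P ^ i , P ^ j))
      ≡⟨ ∑-splits-suc n (λ (i , j) → unitaryPart (P ^ i , P ^ j)) ⟩
    unitaryPart (𝟏 , P ^ suc n) + ∑ (splits n) (λ (i , j) → unitaryPart (P ^ suc i , P ^ j))
      ≡⟨ cong₂ _+_ (unitaryPart-coprime {𝟏} {P ^ suc n} (λ ()) (Coprime-𝟏ˡ _))
                   (∑-splits-last n (λ (i , j) → unitaryPart (P ^ suc i , P ^ j)) shared-factor) ⟩
    𝟏 + unitaryPart (P ^ suc n , 𝟏)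
      ≡⟨ cong (𝟏 +_) (unitaryPart-coprime {P ^ suc n} {𝟏} P^n+1≢𝟎 (Coprime-sym (Coprime-𝟏ˡ _))) ⟩
    𝟏 + P ^ suc n
      ∎
    where
    P^n+1≢𝟎 = ^-≢𝟎 (suc n) Irreducible⇒≢𝟎
    shared-factor : ∀ i j → unitaryPart (P ^ suc i , P ^ suc j) ≡ 𝟎
    shared-factor i j = unitaryPart-¬coprime {P ^ suc i} {P ^ suc j} λ P^i+1⊥P^j+1 →
      Irreducible⇒≢𝟏 (P^i+1⊥P^j+1 P (m∣m*n P (P ^ i)) (m∣m*n P (P ^ j)))

  module _ {φ : Poly → Poly} (φ-isPhi : IsPhi φ) where

    φ-𝟏 : φ 𝟏 ≡ 𝟏
    φ-𝟏 = proj₁ φ-isPhi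

    φ-power : ∀ r → φ (P ^ suc r) ≡ P ^ suc r + P ^ r
    φ-power r = proj₂ (proj₂ φ-isPhi) P r P-irr

    ∑-φ-powers : ∀ m → ∑ (splits m) (λ (_ , j) → φ (P ^ j)) ≡ P ^ m
    ∑-φ-powers zero    = trans (+-identityʳ (φ 𝟏)) φ-𝟏
    ∑-φ-powers (suc m) = begin
      ∑ (splits (suc m)) (λ (_ , j) → φ (P ^ j))           ≡⟨ ∑-splits-suc m (λ (_ , j) → φ (P ^ j)) ⟩
      φ (P ^ suc m) + ∑ (splits m) (λ (_ , j) → φ (P ^ j)) ≡⟨ cong₂ _+_ (φ-power m) (∑-φ-powers m) ⟩
      P ^ suc m + P ^ m + P ^ m                            ≡⟨ a+b+b≡a (P ^ suc m) (P ^ m) ⟩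
      P ^ suc m                                            ∎

    weightedSum : ℕ → Poly
    weightedSum m = ∑ (splits m) (λ (i , j) → P ^ i * φ (P ^ j))

    weightedSum-shift : ∀ m → ∑ (splits m) (λ (i , j) → P ^ suc i * φ (P ^ j)) ≡ P * weightedSum m
    weightedSum-shift m = begin
      ∑ (splits m) (λ (i , j) → (P * P ^ i) * φ (P ^ j))
        ≡⟨ ∑-cong (splits m) (λ {x} _ → *-assoc P (P ^ proj₁ x) _) ⟩
      ∑ (splits m) (λ (i , j) → P * (P ^ i * φ (P ^ j)))
        ≡⟨ ∑-*ˡ (splits m) (λ (i , j) → P ^ i * φ (P ^ j)) P ⟨
      P * weightedSum m                                  ∎

    weightedSum-suc : ∀ m → weightedSum (suc m) ≡ φ (P ^ suc m) + P * weightedSum m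
    weightedSum-suc m =
      trans (∑-splits-suc m (λ (i , j) → P ^ i * φ (P ^ j))) (cong (φ (P ^ suc m) +_) (weightedSum-shift m))

    weightedSum-odd-step : ∀ m → weightedSum m ≡ P ^ m → weightedSum (suc m) ≡ P ^ m
    weightedSum-odd-step m W≡ = begin
      weightedSum (suc m)                 ≡⟨ weightedSum-suc m ⟩
      φ (P ^ suc m) + P * weightedSum m   ≡⟨ cong₂ _+_ (φ-power m) (cong (P *_) W≡) ⟩
      P ^ suc m + P ^ m + P ^ suc m       ≡⟨ a+b+a≡b (P ^ suc m) (P ^ m) ⟩
      P ^ m                               ∎

    weightedSum-even-step : ∀ m → weightedSum (suc m) ≡ P ^ m → weightedSum (suc (suc m)) ≡ P ^ suc (suc m)
    weightedSum-even-step m W≡ = begin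
      weightedSum (suc (suc m))                           ≡⟨ weightedSum-suc (suc m) ⟩
      φ (P ^ suc (suc m)) + P * weightedSum (suc m)       ≡⟨ cong₂ _+_ (φ-power (suc m)) (cong (P *_) W≡) ⟩
      P ^ suc (suc m) + P ^ suc m + P ^ suc m             ≡⟨ a+b+b≡a (P ^ suc (suc m)) (P ^ suc m) ⟩
      P ^ suc (suc m)                                     ∎

    weightedSum-even : ∀ m → parity m ≡ 0ℙ → weightedSum m ≡ P ^ m × weightedSum (suc m) ≡ P ^ m
    weightedSum-even zero          _      = W₀≡𝟏 , weightedSum-odd-step 0 W₀≡𝟏
      where
      W₀≡𝟏 : weightedSum 0 ≡ 𝟏
      W₀≡𝟏 = trans (+-identityʳ (φ 𝟏)) φ-𝟏
    weightedSum-even (suc (suc m)) m-even with _ , W≡ ← weightedSum-even m m-even =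
      weightedSum-even-step m W≡ , weightedSum-odd-step (suc (suc m)) (weightedSum-even-step m W≡)

    σ*⋆φ[P^even] : ∀ n → parity n ≡ 0ℙ → (σ* ⋆ φ) (P ^ n) ≡ φ (P ^ n)
    σ*⋆φ[P^even] n n-even = trans (divisorSum-power n (λ (d , q) → σ* d * φ q)) (even-case n n-even)
      where
      even-case : ∀ n → parity n ≡ 0ℙ → ∑ (splits n) (λ (i , j) → σ* (P ^ i) * φ (P ^ j)) ≡ φ (P ^ n)
      even-case zero          _      = +-identityʳ (φ 𝟏)
      even-case (suc (suc m)) m-even = begin
        ∑ (splits (suc k)) (λ (i , j) → σ* (P ^ i) * φ (P ^ j))
          ≡⟨ ∑-splits-suc k (λ (i , j) → σ* (P ^ i) * φ (P ^ j)) ⟩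
        φ (P ^ suc k) + ∑ (splits k) (λ (i , j) → σ* (P ^ suc i) * φ (P ^ j))
          ≡⟨ cong (φ (P ^ suc k) +_) (∑-cong (splits k) λ {x} _ → σ*-term (proj₁ x) (proj₂ x)) ⟩
        φ (P ^ suc k) + ∑ (splits k) (λ (i , j) → φ (P ^ j) + P ^ suc i * φ (P ^ j))
          ≡⟨ cong (φ (P ^ suc k) +_) (∑-+ (splits k) (λ (_ , j) → φ (P ^ j)) (λ (i , j) → P ^ suc i * φ (P ^ j))) ⟩
        φ (P ^ suc k) + (∑ (splits k) (λ (_ , j) → φ (P ^ j)) + ∑ (splits k) (λ (i , j) → P ^ suc i * φ (P ^ j)))
          ≡⟨ cong (φ (P ^ suc k) +_) (cong₂ _+_ (∑-φ-powers k) (weightedSum-shift k)) ⟩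
        φ (P ^ suc k) + (P ^ k + P * weightedSum k)
          ≡⟨ cong (λ z → φ (P ^ suc k) + (P ^ k + P * z)) (proj₂ (weightedSum-even m m-even)) ⟩
        φ (P ^ suc k) + (P ^ k + P ^ k)
          ≡⟨ trans (cong (φ (P ^ suc k) +_) (p+p≡𝟎 (P ^ k))) (+-identityʳ _) ⟩
        φ (P ^ suc k)   ∎
        where
        k = suc m
        σ*-term : ∀ i j → σ* (P ^ suc i) * φ (P ^ j) ≡ φ (P ^ j) + P ^ suc i * φ (P ^ j)
        σ*-term i j = trans (cong (_* φ (P ^ j)) (σ*[P^n+1] i)) (*-distribʳ (φ (P ^ j)) 𝟏 (P ^ suc i))

-- Factorisation into irreducibles

degree-induction : (Q : Poly → Set) → (∀ A → (∀ B → degP B < degP A → Q B) → Q A) → ∀ A → Q A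
degree-induction Q step A = <-rec (λ n → ∀ A → degP A ≡ n → Q A)
  (λ n ih A deg-A≡n → step A λ B B<A → ih (subst (degP B <_) deg-A≡n B<A) B refl) (degP A) A refl

deg≡0⇒≡one : ∀ p → deg p ≡ 0 → p ≡ one
deg≡0⇒≡one one      _ = refl

≢𝟏⇒1≤deg : ∀ d → nz d ≢ 𝟏 → 1 ≤ deg d
≢𝟏⇒1≤deg one      d≢𝟏 = ⊥-elim (d≢𝟏 refl)
≢𝟏⇒1≤deg (_ ∷⁺ _) _   = s≤s z≤n

∣∧deg≡⇒≡ : ∀ {d a} → nz d ∣ nz a → deg d ≡ deg a → nz d ≡ nz a
∣∧deg≡⇒≡ {d} {a} (𝟎 , d𝟎≡a) with () ← trans (sym (*-𝟎 (nz d))) d𝟎≡a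
∣∧deg≡⇒≡ {d} {a} (nz q , dq≡a) deg-d≡deg-a
  with r , dq≡r , deg-r ← *⁺-deg d q with refl ← trans (sym dq≡r) dq≡a =
  trans (sym (*-identityʳ (nz d))) (trans (cong (λ q → nz d * nz q) (sym q≡one)) dq≡r)
  where
  deg-d+deg-q≡deg-d+0 : deg d +ℕ deg q ≡ deg d +ℕ 0
  deg-d+deg-q≡deg-d+0 = trans (sym deg-r) (trans (sym deg-d≡deg-a) (sym (ℕ.+-identityʳ (deg d))))
  q≡one : q ≡ one
  q≡one = deg≡0⇒≡one q (ℕ.+-cancelˡ-≡ (deg d) (deg q) 0 deg-d+deg-q≡deg-d+0)

proper-divisor-or-irreducible : ∀ a → 1 ≤ deg a →
  (∃ λ d → nz d ∣ nz a × 1 ≤ deg d × deg d < deg a) ⊎ Irreducible (nz a)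
proper-divisor-or-irreducible a 1≤deg-a
  with any? (λ d → (nz d ∣? nz a) ×-dec (¬? (nz d ≟ 𝟏) ×-dec ¬? (nz d ≟ nz a))) (allP⁺ (deg a))
... | yes has-proper with d , d∣a , d≢𝟏 , d≢a ← satisfied has-proper =
  inj₁ (d , d∣a , ≢𝟏⇒1≤deg d d≢𝟏 , ℕ.≤∧≢⇒< (∣-deg d a d∣a) (d≢a ∘ ∣∧deg≡⇒≡ d∣a))
... | no no-proper = inj₂ (1≤deg-a , only-trivial)
  where
  only-trivial : ∀ D → D ∣ nz a → D ≡ 𝟏 ⊎ D ≡ nz a
  only-trivial 𝟎 (_ , ())
  only-trivial (nz d) d∣a with nz d ≟ 𝟏 | nz d ≟ nz a
  ... | yes d≡𝟏 | _       = inj₁ d≡𝟏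
  ... | no _    | yes d≡a = inj₂ d≡a
  ... | no d≢𝟏  | no d≢a  =
    ⊥-elim (no-proper (∈⇒Any (allP⁺-complete d (deg a) (∣-deg d a d∣a)) (d∣a , d≢𝟏 , d≢a)))

irreducible-factor : ∀ A → 1 ≤ degP A → ∃ λ P → Irreducible P × P ∣ A
irreducible-factor = degree-induction (λ A → 1 ≤ degP A → ∃ λ P → Irreducible P × P ∣ A) step
  where
  step : ∀ A → (∀ B → degP B < degP A → 1 ≤ degP B → ∃ λ P → Irreducible P × P ∣ B) →
         1 ≤ degP A → ∃ λ P → Irreducible P × P ∣ A
  step (nz a) ih 1≤deg-a with proper-divisor-or-irreducible a 1≤deg-a
  ... | inj₂ a-irr = nz a , a-irr , ∣-refl (nz a)
  ... | inj₁ (d , d∣a , 1≤deg-d , deg-d<deg-a) with P , P-irr , P∣d ← ih (nz d) deg-d<deg-a 1≤deg-d =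
    P , P-irr , ∣-trans P P∣d d∣a

cofactor-degP< : ∀ {D Q A} → 1 ≤ degP D → D * Q ≡ A → A ≢ 𝟎 → degP Q < degP A
cofactor-degP< {D} {Q} 1≤deg-D DQ≡A A≢𝟎 =
  subst (degP Q <_) (trans (sym (degP-* D≢𝟎 Q≢𝟎)) (cong degP DQ≡A)) (ℕ.m<n+m (degP Q) 1≤deg-D)
  where
  DQ≢𝟎 : D * Q ≢ 𝟎
  DQ≢𝟎 = subst (_≢ 𝟎) (sym DQ≡A) A≢𝟎
  D≢𝟎 = *-≢𝟎⇒≢𝟎ˡ D Q DQ≢𝟎
  Q≢𝟎 = *-≢𝟎⇒≢𝟎ʳ D Q DQ≢𝟎

split-power : ∀ {P} → Irreducible P → ∀ A → A ≢ 𝟎 → P ∣ A → ∃₂ λ r N → A ≡ P ^ suc r * N × ¬ P ∣ N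
split-power {P} P-irr = degree-induction (λ A → A ≢ 𝟎 → P ∣ A → ∃₂ λ r N → A ≡ P ^ suc r * N × ¬ P ∣ N) step
  where
  step : ∀ A → (∀ B → degP B < degP A → B ≢ 𝟎 → P ∣ B → ∃₂ λ r N → B ≡ P ^ suc r * N × ¬ P ∣ N) →
         A ≢ 𝟎 → P ∣ A → ∃₂ λ r N → A ≡ P ^ suc r * N × ¬ P ∣ N
  step A ih A≢𝟎 (A′ , PA′≡A) with P ∣? A′
  ... | no P∤A′ = 0 , A′ , trans (sym PA′≡A) (cong (_* A′) (sym (*-identityʳ P))) , P∤A′
  ... | yes P∣A′
    with r , N , refl , P∤N ← ih A′ (cofactor-degP< {P} {A′} (proj₁ P-irr) PA′≡A A≢𝟎)
                                    (*-≢𝟎⇒≢𝟎ʳ P A′ (subst (_≢ 𝟎) (sym PA′≡A) A≢𝟎)) P∣A′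
    = suc r , N , trans (sym PA′≡A) (sym (*-assoc P (P ^ suc r) N)) , P∤N

Coprime-^ : ∀ {P N} → Irreducible P → ¬ P ∣ N → ∀ k → Coprime (P ^ k) N
Coprime-^ P-irr P∤N zero    = Coprime-𝟏ˡ _
Coprime-^ P-irr P∤N (suc k) = Coprime-*ˡ (Irreducible⇒Coprime P-irr P∤N) (Coprime-^ P-irr P∤N k)

Irreducible-∣-^ : ∀ {Q P} → Irreducible Q → Irreducible P → ∀ k → Q ∣ P ^ k → Q ≡ P
Irreducible-∣-^ {Q} Q-irr P-irr zero    (R , QR≡𝟏) = ⊥-elim (Irreducible⇒≢𝟏 Q-irr (*≡𝟏⇒≡𝟏 Q R QR≡𝟏))
Irreducible-∣-^ {Q} {P} Q-irr P-irr (suc k) Q∣P^k+1 with euclidsLemma P (P ^ k) Q-irr Q∣P^k+1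
... | inj₂ Q∣P^k = Irreducible-∣-^ Q-irr P-irr k Q∣P^k
... | inj₁ Q∣P with proj₂ P-irr Q Q∣P
...   | inj₁ Q≡𝟏 = ⊥-elim (Irreducible⇒≢𝟏 Q-irr Q≡𝟏)
...   | inj₂ Q≡P = Q≡P

EvenExponents : Poly → Set
EvenExponents A = ∀ P e N → Irreducible P → A ≡ P ^ e * N → ¬ P ∣ N → parity e ≡ 0ℙ

EvenExponents-cofactor : ∀ {A P e N} → EvenExponents A → Irreducible P → A ≡ P ^ e * N → ¬ P ∣ N →
                         EvenExponents N
EvenExponents-cofactor {A} {P} {e} {N} A-even P-irr A≡P^eN P∤N Q zero    N′ Q-irr N≡Q^sN′ Q∤N′ = refl
EvenExponents-cofactor {A} {P} {e} {N} A-even P-irr A≡P^eN P∤N Q (suc s) N′ Q-irr N≡Q^sN′ Q∤N′ =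
  A-even Q (suc s) (P ^ e * N′) Q-irr A≡Q^sP^eN′ Q∤P^eN′
  where
  A≡Q^sP^eN′ : A ≡ Q ^ suc s * (P ^ e * N′)
  A≡Q^sP^eN′ = trans A≡P^eN (trans (cong (P ^ e *_) N≡Q^sN′) (*-swap-left (P ^ e) (Q ^ suc s) N′))
  Q∤P^eN′ : ¬ Q ∣ P ^ e * N′
  Q∤P^eN′ Q∣P^eN′ with euclidsLemma (P ^ e) N′ Q-irr Q∣P^eN′
  ... | inj₂ Q∣N′ = Q∤N′ Q∣N′
  ... | inj₁ Q∣P^e with refl ← Irreducible-∣-^ Q-irr P-irr e Q∣P^e =
    P∤N (subst (Q ∣_) (sym N≡Q^sN′) (∣m⇒∣m*n Q N′ (m∣m*n Q (Q ^ s))))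

-- Both sides are multiplicative and agree at prime powers with even exponent.
σ*⋆φ≡φ : ∀ {φ} → IsPhi φ → ∀ A → A ≢ 𝟎 → EvenExponents A → (σ* ⋆ φ) A ≡ φ A
σ*⋆φ≡φ {φ} φ-isPhi@(_ , φ-multiplicative , _) =
  degree-induction (λ A → A ≢ 𝟎 → EvenExponents A → (σ* ⋆ φ) A ≡ φ A) step
  where
  step : ∀ A → (∀ B → degP B < degP A → B ≢ 𝟎 → EvenExponents B → (σ* ⋆ φ) B ≡ φ B) →
         A ≢ 𝟎 → EvenExponents A → (σ* ⋆ φ) A ≡ φ A
  step 𝟎      _  A≢𝟎 _ = ⊥-elim (A≢𝟎 refl)
  step (nz one) _ _ _ = +-identityʳ (φ 𝟏)
  step A@(nz (b ∷⁺ a)) ih A≢𝟎 A-even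
    with P , P-irr , P∣A ← irreducible-factor A (s≤s z≤n)
    with r , N , A≡P^r+1N , P∤N ← split-power P-irr A A≢𝟎 P∣A = begin
    (σ* ⋆ φ) A
      ≡⟨ cong (σ* ⋆ φ) A≡P^r+1N ⟩
    (σ* ⋆ φ) (P ^ suc r * N)
      ≡⟨ ⋆-multiplicative {σ*} {φ} σ*-multiplicative (λ M⊥N _ _ → φ-multiplicative _ _ M⊥N) P^r+1⊥N P^r+1≢𝟎 N≢𝟎 ⟩
    (σ* ⋆ φ) (P ^ suc r) * (σ* ⋆ φ) N
      ≡⟨ cong₂ _*_ (σ*⋆φ[P^even] P-irr φ-isPhi (suc r) (A-even P (suc r) N P-irr A≡P^r+1N P∤N))
                   (ih N deg-N<deg-A N≢𝟎 (EvenExponents-cofactor {e = suc r} A-even P-irr A≡P^r+1N P∤N)) ⟩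
    φ (P ^ suc r) * φ N
      ≡⟨ φ-multiplicative _ _ P^r+1⊥N ⟨
    φ (P ^ suc r * N)
      ≡⟨ cong φ A≡P^r+1N ⟨
    φ A
      ∎
    where
    P^r+1⊥N : Coprime (P ^ suc r) N
    P^r+1⊥N = Coprime-^ P-irr P∤N (suc r)
    P^r+1≢𝟎 : P ^ suc r ≢ 𝟎
    P^r+1≢𝟎 = ^-≢𝟎 (suc r) (Irreducible⇒≢𝟎 P-irr)
    N≢𝟎 : N ≢ 𝟎
    N≢𝟎 = *-≢𝟎⇒≢𝟎ʳ (P ^ suc r) N (subst (_≢ 𝟎) A≡P^r+1N A≢𝟎)
    deg-N<deg-A : degP N < degP A
    deg-N<deg-A = cofactor-degP< {P ^ suc r} {N} 1≤deg-P^r+1 (sym A≡P^r+1N) A≢𝟎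
      where
      1≤deg-P^r+1 : 1 ≤ degP (P ^ suc r)
      1≤deg-P^r+1 = subst (1 ≤_) (sym (degP-* (Irreducible⇒≢𝟎 P-irr) (^-≢𝟎 r (Irreducible⇒≢𝟎 P-irr))))
                          (ℕ.≤-trans (proj₁ P-irr) (ℕ.m≤m+n (degP P) _))

-- Odd perfect polynomials

𝕩 : Poly
𝕩 = nz (false ∷⁺ one)

𝕩-irreducible : Irreducible 𝕩
𝕩-irreducible = s≤s z≤n , only-trivial
  where
  only-trivial : ∀ D → D ∣ 𝕩 → D ≡ 𝟏 ⊎ D ≡ 𝕩
  only-trivial 𝟎             (_ , ())
  only-trivial (nz one)      _   = inj₁ refl
  only-trivial (nz (b ∷⁺ d)) D∣𝕩 = inj₂ (∣∧deg≡⇒≡ D∣𝕩 (ℕ.≤-antisym (∣-deg (b ∷⁺ d) _ D∣𝕩) (s≤s z≤n)))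

-- P has constant term 1: otherwise x ∣ P, so P = x would be a linear factor of A.
𝕩∣𝟏+P : ∀ {A P} → Odd A → Irreducible P → P ∣ A → 𝕩 ∣ 𝟏 + P
𝕩∣𝟏+P {A} {P} (_ , no-linear-factor) P-irr P∣A with cons-split P
... | true  , P′ , refl = P′ , sym (cons-+-cons true true 𝟎 P′)
... | false , P′ , refl with proj₂ P-irr 𝕩 (P′ , refl)
...   | inj₁ ()
...   | inj₂ 𝕩≡P = ⊥-elim (no-linear-factor P P-irr P∣A (cong degP (sym 𝕩≡P)))

odd-perfect⇒EvenExponents : ∀ {A} → Odd A → Perfect A → EvenExponents A
odd-perfect⇒EvenExponents {A} A-odd A-perfect P zero N P-irr A≡P^eN P∤N = refl
odd-perfect⇒EvenExponents {A} A-odd A-perfect P (suc r) N P-irr A≡P^eN P∤N with parity (suc r) in e-parity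
... | 0ℙ = refl
... | 1ℙ = ⊥-elim (proj₂ A-odd 𝕩 𝕩-irreducible 𝕩∣A refl)
  where
  P^e≢𝟎 : P ^ suc r ≢ 𝟎
  P^e≢𝟎 = ^-≢𝟎 (suc r) (Irreducible⇒≢𝟎 P-irr)
  N≢𝟎 : N ≢ 𝟎
  N≢𝟎 = *-≢𝟎⇒≢𝟎ʳ (P ^ suc r) N (subst (_≢ 𝟎) A≡P^eN (proj₁ A-odd))
  σA≡ : σ A ≡ σ (P ^ suc r) * σ N
  σA≡ = trans (cong σ A≡P^eN) (σ-multiplicative (Coprime-^ P-irr P∤N (suc r)) P^e≢𝟎 N≢𝟎)
  𝟏+P∣A : (𝟏 + P) ∣ A
  𝟏+P∣A = subst ((𝟏 + P) ∣_) (trans (sym σA≡) A-perfect)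
                (∣m⇒∣m*n (𝟏 + P) (σ N) (𝟏+P∣σ[P^odd] P-irr (suc r) e-parity))
  P∣A : P ∣ A
  P∣A = P ^ r * N , trans (sym (*-assoc P (P ^ r) N)) (sym A≡P^eN)
  𝕩∣A : 𝕩 ∣ A
  𝕩∣A = ∣-trans 𝕩 (𝕩∣𝟏+P A-odd P-irr P∣A) 𝟏+P∣A

non-proper-divisorPairs : ∀ a → 1 ≤ deg a →
  filter (¬? ∘ IsProper? (nz a)) (divisorPairs (nz a)) ↭ (one , nz a) ∷ (a , 𝟏) ∷ []
non-proper-divisorPairs a 1≤deg-a =
  unique∧set⇒↭ (Unique.filter⁺ (¬? ∘ IsProper? A) (divisorPairs-unique A))
               (((one≢a ∘ cong proj₁) All.∷ All.[]) ∷ All.[] ∷ []) ⊆ ⊇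
  where
  A = nz a
  one≢a : one ≢ a
  one≢a refl = ℕ.<-irrefl refl 1≤deg-a
  ⊆ : ∀ {x} → x ∈ filter (¬? ∘ IsProper? A) (divisorPairs A) → x ∈ (one , A) ∷ (a , 𝟏) ∷ []
  ⊆ {d , q} x∈ with x∈L , not-proper ← ∈-filter⁻ (¬? ∘ IsProper? A) {xs = divisorPairs A} x∈
    with nz d ≟ 𝟏 | nz d ≟ A
  ... | yes refl | _        = here (cong (one ,_) (∈-divisorPairs⁻ A x∈L))
  ... | no _     | yes refl =
    there (here (cong (a ,_) (*-cancelˡ A (λ ()) (trans (∈-divisorPairs⁻ A x∈L) (sym (*-identityʳ A))))))
  ... | no d≢𝟏   | no d≢A   = ⊥-elim (not-proper (d≢𝟏 , d≢A))
  ⊇ : ∀ {x} → x ∈ (one , A) ∷ (a , 𝟏) ∷ [] → x ∈ filter (¬? ∘ IsProper? A) (divisorPairs A)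
  ⊇ (here refl)         =
    ∈-filter⁺ (¬? ∘ IsProper? A) (∈-divisorPairs⁺ a refl) (λ (one≢𝟏 , _) → one≢𝟏 refl)
  ⊇ (there (here refl)) =
    ∈-filter⁺ (¬? ∘ IsProper? A) (∈-divisorPairs⁺ a (*-identityʳ A)) (λ (_ , a≢A) → a≢A refl)

x≡s+[x+y]⇒y≡s : ∀ s x y → x ≡ s + (x + y) → y ≡ s
x≡s+[x+y]⇒y≡s s x y x≡ = sym (+≡𝟎⇒≡ s y (begin
  s + y             ≡⟨ a+b+b≡a (s + y) x ⟨
  (s + y) + x + x   ≡⟨ cong (_+ x) (regroup s x y) ⟨
  s + (x + y) + x   ≡⟨ cong (_+ x) x≡ ⟨
  x + x             ≡⟨ p+p≡𝟎 x ⟩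
  𝟎                 ∎))
  where
  regroup : ∀ s x y → s + (x + y) ≡ (s + y) + x
  regroup = solve-∀ ring

corollary3p24 : (A : Poly) → 1 ≤ degP A → Odd A → Perfect A →
    (φ : Poly → Poly) → IsPhi φ →
    σ* A ≡ sumP (map (λ x → σ* (nz (Data.Product.proj₁ x)) * φ (Data.Product.proj₂ x))
                     (filter (IsProper? A) (divisorPairs A)))
corollary3p24 (nz a) 1≤deg-a A-odd A-perfect φ φ-isPhi@(φ-𝟏 , _) =
  x≡s+[x+y]⇒y≡s (∑ proper term) (φ A) (σ* A) (begin
    φ A
      ≡⟨ σ*⋆φ≡φ φ-isPhi A (λ ()) (odd-perfect⇒EvenExponents A-odd A-perfect) ⟨
    (σ* ⋆ φ) A
      ≡⟨ ∑-map (λ (d , q) → nz d , q) (divisorPairs A) (λ (d , q) → σ* d * φ q) ⟩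
    ∑ (divisorPairs A) term
      ≡⟨ ∑-partition (IsProper? A) (divisorPairs A) term ⟩
    ∑ proper term + ∑ non-proper term
      ≡⟨ cong (∑ proper term +_) (∑-↭ term (non-proper-divisorPairs a 1≤deg-a)) ⟩
    ∑ proper term + (φ A + (σ* A * φ 𝟏 + 𝟎))
      ≡⟨ cong (λ z → ∑ proper term + (φ A + z)) σ*[A]φ[𝟏]+𝟎≡σ*[A] ⟩
    ∑ proper term + (φ A + σ* A)
      ∎)
  where
  A = nz a
  term : P⁺ × Poly → Poly
  term (d , q) = σ* (nz d) * φ q
  proper = filter (IsProper? A) (divisorPairs A)
  non-proper = filter (¬? ∘ IsProper? A) (divisorPairs A)
  σ*[A]φ[𝟏]+𝟎≡σ*[A] : σ* A * φ 𝟏 + 𝟎 ≡ σ* A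
  σ*[A]φ[𝟏]+𝟎≡σ*[A] = trans (+-identityʳ _) (trans (cong (σ* A *_) φ-𝟏) (*-identityʳ (σ* A)))
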